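{- For any nonnegative integers $a,b_1,b_2$ and any positive integers $r,s_1,s_2$, in the shuffle algebra $(\mathfrak{h},\sqcup\!\sqcup)$, \begin{align*} &x^ay^r\;\sqcup\!\sqcup\; x^{b_1}y^{s_1}x^{b_2}y^{s_2}=\sum_{\substack{\alpha_1+\cdots+\alpha_{r+s_1+s_2}=a+b_1+b_2\\ \alpha_i\ge0}}\Bigg\{\sum_{\substack{r_1+r_2+r_3+r_4=r\\ r_1\ge1,\ r_2,r_3,r_4\ge0}}\binom{\alpha_1}{a}\binom{r_2+s_1-2}{r_2}\binom{r_4+s_2-1}{r_4}\\ &\qquad\times\delta_{\alpha_1+\cdots+\alpha_{r_1+1},\,a+b_1}\prod_{i=r_1+2}^{r_1+r_2+s_1}\delta_{\alpha_i,0}\prod_{i=r_1+r_2+r_3+s_1+2}^{r+s_1+s_2}\delta_{\alpha_i,0}\\ &\quad+\sum_{\substack{r_1+r_2+r_3=r,\ r_1\ge1,\ r_2,r_3\ge0\\ 1\le l\le s_1-1}}\binom{\alpha_1}{b_1}\binom{r_1+s_1-l-2}{r_1-1}\binom{r_3+s_2-1}{r_3}\delta_{\alpha_1+\cdots+\alpha_{l+1},\,a+b_1}\prod_{i=l+2}^{r_1+s_1}\delta_{\alpha_i,0}\prod_{i=r_1+r_2+s_1+2}^{r+s_1+s_2}\delta_{\alpha_i,0}\\ &\quad+\sum_{\substack{r_1+r_2=r\\ r_1\ge1,\ r_2\ge0}}\binom{\alpha_1}{b_1}\binom{\alpha_{s_1+1}}{a+b_1-\sum_{i=1}^{s_1}\alpha_i}\binom{r_2+s_2-1}{r_2}\prod_{i=r_1+s_1+2}^{r+s_1+s_2}\delta_{\alpha_i,0}\\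 &\quad+\sum_{l=1}^{s_2}\binom{\alpha_1}{b_1}\binom{\alpha_{s_1+1}}{b_2}\binom{r+s_2-l-1}{r-1}\prod_{i=s_1+l+2}^{r+s_1+s_2}\delta_{\alpha_i,0}\Bigg\}x^{\alpha_1}y\cdots x^{\alpha_{r+s_1+s_2}}y. \end{align*}
   Context: $\mathfrak{h}=\mathbb{Q}\langle x,y\rangle$ is spanned by words in the noncommuting letters $x,y$ (including the empty word $1$); the shuffle product $\sqcup\!\sqcup$ is defined bilinearly by $1\sqcup\!\sqcup w=w\sqcup\!\sqcup1=w$ and $aw_1\sqcup\!\sqcup bw_2=a(w_1\sqcup\!\sqcup bw_2)+b(aw_1\sqcup\!\sqcup w_2)$ for letters $a,b$ and words $w,w_1,w_2$. Conventions: $\delta_{ij}$ is the Kronecker delta; for integers $\alpha,\beta$, $\binom{\alpha}{\beta}=0$ if $\beta<0$ or $\alpha<\beta$; empty products equal $1$; all summation indices are nonnegative integers unless stated otherwise. -}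

module Defs where

open import Data.Nat using (ℕ; zero; suc; _+_; _*_; _∸_; _≟_)
open import Data.Nat.Combinatorics using (_C_)
open import Data.Integer as ℤ using (ℤ; +_; -[1+_])
open import Data.List using (List; []; _∷_; _++_; map; concat; concatMap; replicate; take; upTo; foldr)
open import Data.List.Properties using (≡-dec)
open import Data.Nat.ListAction using (sum; product)
open import Data.Product using (_×_; _,_)
open import Relation.Binary.PropositionalEquality using (_≡_; refl)
open import Relation.Nullary using (Dec; yes; no)

data Letter : Set where
  x y : Letter

_≟L_ : (a b : Letter) → Dec (a ≡ b)
x ≟L x = yes refl
x ≟L y = no λ ()
y ≟L x = no λ ()
y ≟L y = yes refl

Word : Set
Word = List Letter

_≟W_ : (u v : Word) → Dec (u ≡ v)
_≟W_ = ≡-dec _≟L_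

-- Elements of 𝔥 whose coefficients are nonnegative integers, as finite formal
-- linear combinations  Σ c·w  (a list of (coefficient, word) pairs).
Poly : Set
Poly = List (ℕ × Word)

coeff : Poly → Word → ℕ
coeff [] w = 0
coeff ((c , u) ∷ p) w with u ≟W w
... | yes _ = c + coeff p w
... | no _  = coeff p w

mon : Word → Poly
mon w = (1 , w) ∷ []

shw : Word → Word → List Word
shw [] v = v ∷ []
shw (a ∷ u) [] = (a ∷ u) ∷ []
shw (a ∷ u) (b ∷ v) = map (a ∷_) (shw u (b ∷ v)) ++ map (b ∷_) (shw (a ∷ u) v)

_⧢_ : Poly → Poly → Poly
p ⧢ q = concatMap (λ { (c , u) → concatMap (λ { (d , v) → map (λ w → (c * d , w)) (shw u v) }) q }) p

-- binomial coefficient on integers: 0 if β < 0 or α < β, except that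
-- binom α 0 = 1 for every α (needed at α = -1)
binom : ℤ → ℤ → ℕ
binom (+ n) (+ k) = n C k
binom (+ n) -[1+ k ] = 0
binom -[1+ n ] (+ zero) = 1
binom -[1+ n ] (+ suc k) = 0
binom -[1+ n ] -[1+ k ] = 0

δ : ℕ → ℕ → ℕ
δ i j with i ≟ j
... | yes _ = 1
... | no _  = 0

-- integers p, p+1, …, q (empty if q < p)
range : ℕ → ℕ → List ℕ
range p q = map (λ i → p + i) (upTo (suc q ∸ p))

sumR : ℕ → ℕ → (ℕ → ℕ) → ℕ
sumR p q f = sum (map f (range p q))

-- α_i with 1-based indexing (α_i = 0 out of range; never used out of range)
at : List ℕ → ℕ → ℕ
at [] i = 0
at (a ∷ α) zero = 0
at (a ∷ α) (suc zero) = a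
at (a ∷ α) (suc (suc i)) = at α (suc i)

psum : List ℕ → ℕ → ℕ
psum α m = sum (take m α)

D0 : List ℕ → ℕ → ℕ → ℕ
D0 α p q = product (map (λ i → δ (at α i) 0) (range p q))

comps : ℕ → ℕ → List (List ℕ)
comps zero zero = [] ∷ []
comps zero (suc n) = []
comps (suc k) n = concatMap (λ i → map (i ∷_) (comps k (n ∸ i))) (range 0 n)

wordOf : List ℕ → Word
wordOf α = concatMap (λ a → replicate a x ++ (y ∷ [])) α

xy : ℕ → ℕ → Word
xy a r = replicate a x ++ replicate r y

coef : ℕ → ℕ → ℕ → ℕ → ℕ → ℕ → List ℕ → ℕ
coef a b₁ b₂ r s₁ s₂ α =
    sumR 1 r (λ r₁ → sumR 0 (r ∸ r₁) (λ r₂ → sumR 0 (r ∸ r₁ ∸ r₂) (λ r₃ →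
      let r₄ = r ∸ r₁ ∸ r₂ ∸ r₃ in
      binom (+ at α 1) (+ a)
      * binom (+ r₂ ℤ.+ + s₁ ℤ.- + 2) (+ r₂)
      * binom (+ r₄ ℤ.+ + s₂ ℤ.- + 1) (+ r₄)
      * δ (psum α (r₁ + 1)) (a + b₁)
      * D0 α (r₁ + 2) (r₁ + r₂ + s₁)
      * D0 α (r₁ + r₂ + r₃ + s₁ + 2) n)))
  + sumR 1 r (λ r₁ → sumR 0 (r ∸ r₁) (λ r₂ →
      let r₃ = r ∸ r₁ ∸ r₂ in
      sumR 1 (s₁ ∸ 1) (λ l →
        binom (+ at α 1) (+ b₁)
        * binom (+ r₁ ℤ.+ + s₁ ℤ.- + l ℤ.- + 2) (+ r₁ ℤ.- + 1)
        * binom (+ r₃ ℤ.+ + s₂ ℤ.- + 1) (+ r₃)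
        * δ (psum α (l + 1)) (a + b₁)
        * D0 α (l + 2) (r₁ + s₁)
        * D0 α (r₁ + r₂ + s₁ + 2) n)))
  + sumR 1 r (λ r₁ →
      let r₂ = r ∸ r₁ in
      binom (+ at α 1) (+ b₁)
      * binom (+ at α (s₁ + 1)) (+ (a + b₁) ℤ.- + psum α s₁)
      * binom (+ r₂ ℤ.+ + s₂ ℤ.- + 1) (+ r₂)
      * D0 α (r₁ + s₁ + 2) n)
  + sumR 1 s₂ (λ l →
      binom (+ at α 1) (+ b₁)
      * binom (+ at α (s₁ + 1)) (+ b₂)
      * binom (+ r ℤ.+ + s₂ ℤ.- + l ℤ.- + 1) (+ r ℤ.- + 1)
      * D0 α (s₁ + l + 2) n)
  where
  n = r + s₁ + s₂

rhs : ℕ → ℕ → ℕ → ℕ → ℕ → ℕ → Poly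
rhs a b₁ b₂ r s₁ s₂ =
  map (λ α → (coef a b₁ b₂ r s₁ s₂ α , wordOf α)) (comps (r + s₁ + s₂) (a + b₁ + b₂))

{-# OPTIONS --safe #-}
module Submission where

-- The coefficient of w in u ⧢ v is the multiplicity mult u v w given by the recursion that
-- defines the shuffle. Every word is wordOf β ++ x^ t, and counting letters and looking at the last
-- letter shows that only t = 0, length β = r + s₁ + s₂ and Σ β = a + b₁ + b₂ can occur. For such a
-- word, its first y is the first y of u or of v, and its α₁ leading x's interleave leading x's of
-- u and of v in a binomial number of ways (mult-x^y). Applying this along the blocks of u = x^a y^r
-- and v = x^b₁ y^s₁ x^b₂ y^s₂ splits the count according to where the first y of u falls: before
-- the first y of v, inside v's first run of y's, right after the x's of v's second block, or inside
-- or after v's last run of y's. Each case is a sum of products of binomials and of indicators of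
-- linear conditions on the partial sums of α; one of these conditions is implied by the others and
-- the total Σ α, and dropping it gives the four sums of the proposition.

open import Defs
open import Data.Nat using (ℕ; zero; suc; _+_; _*_; _∸_; _≤_; _<_; z≤n; s≤s; s≤s⁻¹; _≟_)
open import Data.Nat.Properties
open import Data.Nat.Combinatorics using (_C_; nCn≡1; nCk+nC[k+1]≡[n+1]C[k+1])
open import Data.Nat.Combinatorics.Specification using (k>n⇒nCk≡0)
open import Data.Nat.ListAction using (sum; product)
open import Data.Nat.ListAction.Properties using (sum-++)
open import Data.Nat.Tactic.RingSolver
open import Algebra.Properties.CommutativeSemigroup *-commutativeSemigroup using (x∙yz≈y∙xz)
import Data.Integer as ℤ
import Data.Integer.Properties as ℤP
open import Data.List using (List; []; _∷_; _++_; map; replicate; take; drop; length; concatMap; upTo; applyUpTo)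
open import Data.List.Properties using (++-assoc; ++-identityʳ; map-∘; length-drop; take-all; take-[]; drop-[]; drop-drop; take++drop≡id)
open import Data.Product using (_×_; _,_; proj₁; proj₂; Σ-syntax)
open import Data.Sum using (_⊎_; inj₁; inj₂)
open import Data.Unit using (⊤; tt)
open import Data.Empty using (⊥-elim)
open import Function using (_∘_)
open import Relation.Binary.PropositionalEquality
open import Relation.Nullary using (¬_; yes; no)

eqLetter : Letter → Letter → ℕ
eqLetter x x = 1
eqLetter x y = 0
eqLetter y x = 0
eqLetter y y = 1

eqWord : Word → Word → ℕ
eqWord [] [] = 1
eqWord [] (_ ∷ _) = 0
eqWord (_ ∷ _) [] = 0
eqWord (a ∷ u) (b ∷ w) = eqLetter a b * eqWord u w

eqWord-refl : ∀ u → eqWord u u ≡ 1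
eqWord-refl [] = refl
eqWord-refl (x ∷ u) = trans (+-identityʳ _) (eqWord-refl u)
eqWord-refl (y ∷ u) = trans (+-identityʳ _) (eqWord-refl u)

eqWord-≢ : ∀ u w → u ≢ w → eqWord u w ≡ 0
eqWord-≢ [] [] u≢w = ⊥-elim (u≢w refl)
eqWord-≢ [] (_ ∷ _) _ = refl
eqWord-≢ (_ ∷ _) [] _ = refl
eqWord-≢ (x ∷ u) (x ∷ w) u≢w = trans (+-identityʳ _) (eqWord-≢ u w (u≢w ∘ cong (x ∷_)))
eqWord-≢ (x ∷ u) (y ∷ w) _ = refl
eqWord-≢ (y ∷ u) (x ∷ w) _ = refl
eqWord-≢ (y ∷ u) (y ∷ w) u≢w = trans (+-identityʳ _) (eqWord-≢ u w (u≢w ∘ cong (y ∷_)))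

eqNat : ℕ → ℕ → ℕ
eqNat zero zero = 1
eqNat zero (suc _) = 0
eqNat (suc _) zero = 0
eqNat (suc m) (suc n) = eqNat m n

leNat : ℕ → ℕ → ℕ
leNat zero n = 1
leNat (suc m) zero = 0
leNat (suc m) (suc n) = leNat m n

eqNat-refl : ∀ n → eqNat n n ≡ 1
eqNat-refl zero = refl
eqNat-refl (suc n) = eqNat-refl n

eqNat-≢ : ∀ m n → m ≢ n → eqNat m n ≡ 0
eqNat-≢ zero zero m≢n = ⊥-elim (m≢n refl)
eqNat-≢ zero (suc n) _ = refl
eqNat-≢ (suc m) zero _ = refl
eqNat-≢ (suc m) (suc n) m≢n = eqNat-≢ m n (m≢n ∘ cong suc)

≡⇒eqNat≡1 : ∀ {m n} → m ≡ n → eqNat m n ≡ 1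
≡⇒eqNat≡1 {m} refl = eqNat-refl m

eqNat≡1⇒≡ : ∀ m n → eqNat m n ≡ 1 → m ≡ n
eqNat≡1⇒≡ zero zero _ = refl
eqNat≡1⇒≡ (suc m) (suc n) e = cong suc (eqNat≡1⇒≡ m n e)

δ≡eqNat : ∀ i j → δ i j ≡ eqNat i j
δ≡eqNat i j with i ≟ j
... | yes refl = sym (eqNat-refl i)
... | no i≢j = sym (eqNat-≢ i j i≢j)

eqNat-+-0 : ∀ m n → eqNat (m + n) 0 ≡ eqNat m 0 * eqNat n 0
eqNat-+-0 zero n = sym (+-identityʳ _)
eqNat-+-0 (suc m) n = refl

≤⇒leNat≡1 : ∀ {m n} → m ≤ n → leNat m n ≡ 1
≤⇒leNat≡1 {zero} _ = refl
≤⇒leNat≡1 {suc m} {suc n} (s≤s m≤n) = ≤⇒leNat≡1 m≤n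

>⇒leNat≡0 : ∀ {m n} → n < m → leNat m n ≡ 0
>⇒leNat≡0 {suc m} {zero} _ = refl
>⇒leNat≡0 {suc m} {suc n} (s≤s n<m) = >⇒leNat≡0 n<m

leNat≡1⇒≤ : ∀ m n → leNat m n ≡ 1 → m ≤ n
leNat≡1⇒≤ zero n _ = z≤n
leNat≡1⇒≤ (suc m) (suc n) e = s≤s (leNat≡1⇒≤ m n e)

leNat-0 : ∀ n → leNat n 0 ≡ eqNat n 0
leNat-0 zero = refl
leNat-0 (suc n) = refl

leNat*leNat-∸ : ∀ m n c → leNat m c * leNat n (c ∸ m) ≡ leNat (m + n) c
leNat*leNat-∸ zero n c = +-identityʳ _
leNat*leNat-∸ (suc m) n zero = refl
leNat*leNat-∸ (suc m) n (suc c) = leNat*leNat-∸ m n c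

leNat*eqNat-∸ : ∀ m n c → leNat m c * eqNat n (c ∸ m) ≡ eqNat (m + n) c
leNat*eqNat-∸ zero n c = +-identityʳ _
leNat*eqNat-∸ (suc m) n zero = refl
leNat*eqNat-∸ (suc m) n (suc c) = leNat*eqNat-∸ m n c

IsBit : ℕ → Set
IsBit n = (n ≡ 0) ⊎ (n ≡ 1)

eqNat-bit : ∀ m n → IsBit (eqNat m n)
eqNat-bit zero zero = inj₂ refl
eqNat-bit zero (suc n) = inj₁ refl
eqNat-bit (suc m) zero = inj₁ refl
eqNat-bit (suc m) (suc n) = eqNat-bit m n

leNat-bit : ∀ m n → IsBit (leNat m n)
leNat-bit zero n = inj₂ refl
leNat-bit (suc m) zero = inj₁ refl
leNat-bit (suc m) (suc n) = leNat-bit m n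

*-bit : ∀ {m n} → IsBit m → IsBit n → IsBit (m * n)
*-bit (inj₁ refl) _ = inj₁ refl
*-bit (inj₂ refl) (inj₁ refl) = inj₁ refl
*-bit (inj₂ refl) (inj₂ refl) = inj₂ refl

bit*-implied : ∀ p q → IsBit p → (p ≡ 1 → q ≡ 1) → p * q ≡ p
bit*-implied p q (inj₁ refl) _ = refl
bit*-implied p q (inj₂ refl) p⇒q = trans (+-identityʳ q) (p⇒q refl)

private variable
  X Y : Set

ΣL : List X → (X → ℕ) → ℕ
ΣL L g = sum (map g L)

ΣL-cong : (L : List X) {g h : X → ℕ} → (∀ a → g a ≡ h a) → ΣL L g ≡ ΣL L h
ΣL-cong [] _ = refl
ΣL-cong (a ∷ L) g≗h = cong₂ _+_ (g≗h a) (ΣL-cong L g≗h)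

ΣL-0 : (L : List X) {g : X → ℕ} → (∀ a → g a ≡ 0) → ΣL L g ≡ 0
ΣL-0 [] _ = refl
ΣL-0 (a ∷ L) g≗0 = cong₂ _+_ (g≗0 a) (ΣL-0 L g≗0)

ΣL-++ : (L M : List X) (g : X → ℕ) → ΣL (L ++ M) g ≡ ΣL L g + ΣL M g
ΣL-++ [] M g = refl
ΣL-++ (a ∷ L) M g = trans (cong (g a +_) (ΣL-++ L M g)) (sym (+-assoc (g a) _ _))

ΣL-*ˡ : (c : ℕ) (L : List X) (g : X → ℕ) → c * ΣL L g ≡ ΣL L (λ a → c * g a)
ΣL-*ˡ c [] g = *-zeroʳ c
ΣL-*ˡ c (a ∷ L) g = trans (*-distribˡ-+ c (g a) _) (cong (c * g a +_) (ΣL-*ˡ c L g))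

ΣL-map : (f : X → Y) (L : List X) (g : Y → ℕ) → ΣL (map f L) g ≡ ΣL L (g ∘ f)
ΣL-map f [] g = refl
ΣL-map f (a ∷ L) g = cong (g (f a) +_) (ΣL-map f L g)

ΣL-concatMap : (F : X → List Y) (L : List X) (g : Y → ℕ) →
               ΣL (concatMap F L) g ≡ ΣL L (λ a → ΣL (F a) g)
ΣL-concatMap F [] g = refl
ΣL-concatMap F (a ∷ L) g = trans (ΣL-++ (F a) (concatMap F L) g) (cong (ΣL (F a) g +_) (ΣL-concatMap F L g))

Σ< : ℕ → (ℕ → ℕ) → ℕ
Σ< zero f = 0
Σ< (suc m) f = f 0 + Σ< m (f ∘ suc)

Σ≤ : ℕ → (ℕ → ℕ) → ℕ
Σ≤ k = Σ< (suc k)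

Σ<-congB : ∀ m {f g} → (∀ j → j < m → f j ≡ g j) → Σ< m f ≡ Σ< m g
Σ<-congB zero _ = refl
Σ<-congB (suc m) f≗g = cong₂ _+_ (f≗g 0 (s≤s z≤n)) (Σ<-congB m (λ j j<m → f≗g (suc j) (s≤s j<m)))

Σ<-cong : ∀ m {f g} → (∀ j → f j ≡ g j) → Σ< m f ≡ Σ< m g
Σ<-cong m f≗g = Σ<-congB m (λ j _ → f≗g j)

Σ≤-congB : ∀ k {f g} → (∀ j → j ≤ k → f j ≡ g j) → Σ≤ k f ≡ Σ≤ k g
Σ≤-congB k f≗g = Σ<-congB (suc k) (λ j j<1+k → f≗g j (s≤s⁻¹ j<1+k))

Σ<-0 : ∀ m f → (∀ j → f j ≡ 0) → Σ< m f ≡ 0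
Σ<-0 zero f _ = refl
Σ<-0 (suc m) f f≗0 = cong₂ _+_ (f≗0 0) (Σ<-0 m _ (f≗0 ∘ suc))

Σ<-*ˡ : ∀ c m f → c * Σ< m f ≡ Σ< m (λ j → c * f j)
Σ<-*ˡ c zero f = *-zeroʳ c
Σ<-*ˡ c (suc m) f = trans (*-distribˡ-+ c (f 0) _) (cong (c * f 0 +_) (Σ<-*ˡ c m _))

Σ<-+ : ∀ m f g → Σ< m (λ j → f j + g j) ≡ Σ< m f + Σ< m g
Σ<-+ zero f g = refl
Σ<-+ (suc m) f g = trans (cong (f 0 + g 0 +_) (Σ<-+ m _ _)) (+-+-comm (f 0) (g 0) _ _)
  where
  +-+-comm : ∀ a b c d → a + b + (c + d) ≡ a + c + (b + d)
  +-+-comm = solve-∀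

Σ<-suc : ∀ m f → Σ< (suc m) f ≡ Σ< m f + f m
Σ<-suc zero f = +-identityʳ (f 0)
Σ<-suc (suc m) f = trans (cong (f 0 +_) (Σ<-suc m _)) (sym (+-assoc (f 0) _ _))

Σ<-swap : ∀ m n (f : ℕ → ℕ → ℕ) → Σ< m (λ i → Σ< n (f i)) ≡ Σ< n (λ j → Σ< m (λ i → f i j))
Σ<-swap m zero f = Σ<-0 m _ (λ _ → refl)
Σ<-swap m (suc n) f = trans (Σ<-+ m (λ i → f i 0) (λ i → Σ< n (f i ∘ suc)))
  (cong (Σ< m (λ i → f i 0) +_) (Σ<-swap m n (λ i → f i ∘ suc)))

ΣL-applyUpTo : ∀ (h : ℕ → ℕ) m (g : ℕ → ℕ) → ΣL (applyUpTo h m) g ≡ Σ< m (g ∘ h)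
ΣL-applyUpTo h zero g = refl
ΣL-applyUpTo h (suc m) g = cong (g (h 0) +_) (ΣL-applyUpTo (h ∘ suc) m g)

sumR≡Σ< : ∀ p q f → sumR p q f ≡ Σ< (suc q ∸ p) (λ i → f (p + i))
sumR≡Σ< p q f = trans (ΣL-map (p +_) (upTo (suc q ∸ p)) f) (ΣL-applyUpTo (λ i → i) (suc q ∸ p) _)

Σ≤-eqNat : ∀ m b (g : ℕ → ℕ) → Σ≤ m (λ i → eqNat b i * g i) ≡ leNat b m * g b
Σ≤-eqNat zero zero g = +-identityʳ _
Σ≤-eqNat zero (suc b) g = refl
Σ≤-eqNat (suc m) zero g = trans (cong (1 * g 0 +_) (Σ<-0 (suc m) _ (λ _ → refl))) (+-identityʳ _)
Σ≤-eqNat (suc m) (suc b) g = Σ≤-eqNat m b (g ∘ suc)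

-- Multiplicities in a shuffle

coeff-map : (h : X → ℕ × Word) (L : List X) (w : Word) →
            coeff (map h L) w ≡ ΣL L (λ a → proj₁ (h a) * eqWord (proj₂ (h a)) w)
coeff-map h [] w = refl
coeff-map h (a ∷ L) w with proj₂ (h a) ≟W w
... | yes refl = cong₂ _+_ (sym (trans (cong (proj₁ (h a) *_) (eqWord-refl w)) (*-identityʳ (proj₁ (h a)))))
                         (coeff-map h L w)
... | no u≢w = trans (coeff-map h L w)
                     (sym (cong (_+ ΣL L (λ a → proj₁ (h a) * eqWord (proj₂ (h a)) w))
                                (trans (cong (proj₁ (h a) *_) (eqWord-≢ _ w u≢w)) (*-zeroʳ (proj₁ (h a))))))

mult : Word → Word → Word → ℕ
mult [] v w = eqWord v w
mult (a ∷ u) [] w = eqWord (a ∷ u) w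
mult (a ∷ u) (b ∷ v) [] = 0
mult (a ∷ u) (b ∷ v) (c ∷ w) = eqLetter a c * mult u (b ∷ v) w + eqLetter b c * mult (a ∷ u) v w

ΣL-shw : ∀ u v w → ΣL (shw u v) (λ s → eqWord s w) ≡ mult u v w
ΣL-shw [] v w = +-identityʳ _
ΣL-shw (a ∷ u) [] w = +-identityʳ _
ΣL-shw (a ∷ u) (b ∷ v) w = begin
  ΣL (map (a ∷_) (shw u (b ∷ v)) ++ map (b ∷_) (shw (a ∷ u) v)) (λ s → eqWord s w)
    ≡⟨ ΣL-++ (map (a ∷_) (shw u (b ∷ v))) _ _ ⟩
  ΣL (map (a ∷_) (shw u (b ∷ v))) (λ s → eqWord s w) + ΣL (map (b ∷_) (shw (a ∷ u) v)) (λ s → eqWord s w)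
    ≡⟨ cong₂ _+_ (ΣL-map (a ∷_) (shw u (b ∷ v)) _) (ΣL-map (b ∷_) (shw (a ∷ u) v) _) ⟩
  ΣL (shw u (b ∷ v)) (λ s → eqWord (a ∷ s) w) + ΣL (shw (a ∷ u) v) (λ s → eqWord (b ∷ s) w)
    ≡⟨ first-letter w ⟩
  mult (a ∷ u) (b ∷ v) w ∎
  where
  open ≡-Reasoning
  first-letter : ∀ w → ΣL (shw u (b ∷ v)) (λ s → eqWord (a ∷ s) w) + ΣL (shw (a ∷ u) v) (λ s → eqWord (b ∷ s) w)
                       ≡ mult (a ∷ u) (b ∷ v) w
  first-letter [] = cong₂ _+_ (ΣL-0 (shw u (b ∷ v)) (λ _ → refl)) (ΣL-0 (shw (a ∷ u) v) (λ _ → refl))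
  first-letter (c ∷ w) = cong₂ _+_
    (trans (sym (ΣL-*ˡ (eqLetter a c) (shw u (b ∷ v)) _)) (cong (eqLetter a c *_) (ΣL-shw u (b ∷ v) w)))
    (trans (sym (ΣL-*ˡ (eqLetter b c) (shw (a ∷ u) v) _)) (cong (eqLetter b c *_) (ΣL-shw (a ∷ u) v w)))

coeff-mon⧢mon : ∀ u v w → coeff (mon u ⧢ mon v) w ≡ mult u v w
coeff-mon⧢mon u v w = begin
  coeff (mon u ⧢ mon v) w
    ≡⟨ cong (λ p → coeff p w) (trans (++-identityʳ (map (1 ,_) (shw u v) ++ [])) (++-identityʳ (map (1 ,_) (shw u v)))) ⟩
  coeff (map (1 ,_) (shw u v)) w
    ≡⟨ coeff-map (1 ,_) (shw u v) w ⟩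
  ΣL (shw u v) (λ s → 1 * eqWord s w)
    ≡⟨ ΣL-cong (shw u v) (λ s → *-identityˡ (eqWord s w)) ⟩
  ΣL (shw u v) (λ s → eqWord s w)
    ≡⟨ ΣL-shw u v w ⟩
  mult u v w ∎
  where open ≡-Reasoning

x^ : ℕ → Word
x^ e = replicate e x

y^ : ℕ → Word
y^ k = replicate k y

wordOf-∷ : ∀ e ds → wordOf (e ∷ ds) ≡ x^ e ++ y ∷ wordOf ds
wordOf-∷ e ds = ++-assoc (x^ e) (y ∷ []) (wordOf ds)

wordOf-zeros++ : ∀ m ds → wordOf (replicate m 0 ++ ds) ≡ y^ m ++ wordOf ds
wordOf-zeros++ zero ds = refl
wordOf-zeros++ (suc m) ds = cong (y ∷_) (wordOf-zeros++ m ds)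

wordOf-zeros : ∀ m → wordOf (replicate m 0) ≡ y^ m
wordOf-zeros m = trans (cong wordOf (sym (++-identityʳ (replicate m 0))))
                       (trans (wordOf-zeros++ m []) (++-identityʳ (y^ m)))

eqWord-x^y : ∀ e b V W → eqWord (x^ e ++ y ∷ V) (x^ b ++ y ∷ W) ≡ eqNat b e * eqWord V W
eqWord-x^y zero zero V W = refl
eqWord-x^y zero (suc b) V W = refl
eqWord-x^y (suc e) zero V W = refl
eqWord-x^y (suc e) (suc b) V W = trans (+-identityʳ _) (eqWord-x^y e b V W)

C-pascal : ∀ n k → suc n C suc k ≡ n C k + n C suc k
C-pascal n k = sym (nCk+nC[k+1]≡[n+1]C[k+1] n k)

C-suc*leNat≡0 : ∀ b n → (b C suc n) * leNat b n ≡ 0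
C-suc*leNat≡0 b n with ≤-<-connex b n
... | inj₁ b≤n = cong (_* leNat b n) (k>n⇒nCk≡0 (s≤s b≤n))
... | inj₂ n<b = trans (cong ((b C suc n) *_) (>⇒leNat≡0 n<b)) (*-zeroʳ (b C suc n))

C-suc*leNat : ∀ b n → (suc b C suc n) * leNat b n ≡ (b C n) * leNat b n
C-suc*leNat b n = begin
  (suc b C suc n) * leNat b n                          ≡⟨ cong (_* leNat b n) (C-pascal b n) ⟩
  (b C n + b C suc n) * leNat b n                      ≡⟨ *-distribʳ-+ (leNat b n) (b C n) (b C suc n) ⟩
  (b C n) * leNat b n + (b C suc n) * leNat b n        ≡⟨ cong ((b C n) * leNat b n +_) (C-suc*leNat≡0 b n) ⟩
  (b C n) * leNat b n + 0                              ≡⟨ +-identityʳ _ ⟩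
  (b C n) * leNat b n                                  ∎
  where open ≡-Reasoning

C*leNat-∸ : ∀ b e (F : ℕ → ℕ) → (b C e) * leNat b e * F (e ∸ b) ≡ eqNat b e * F 0
C*leNat-∸ zero zero F = refl
C*leNat-∸ zero (suc e) F = refl
C*leNat-∸ (suc b) zero F = refl
C*leNat-∸ (suc b) (suc e) F = trans (cong (_* F (e ∸ b)) (C-suc*leNat b e)) (C*leNat-∸ b e F)

C*-cong-≤ : ∀ n k {p q} → (k ≤ n → p ≡ q) → (n C k) * p ≡ (n C k) * q
C*-cong-≤ n k {p} {q} p≡q with ≤-<-connex k n
... | inj₁ k≤n = cong ((n C k) *_) (p≡q k≤n)
... | inj₂ n<k = trans (cong (_* p) (k>n⇒nCk≡0 n<k)) (sym (cong (_* q) (k>n⇒nCk≡0 n<k)))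

multichoose : ℕ → ℕ → ℕ
multichoose zero j = eqNat j 0
multichoose (suc m) zero = 1
multichoose (suc m) (suc j) = multichoose m (suc j) + multichoose (suc m) j

multichoose-0 : ∀ m → multichoose m 0 ≡ 1
multichoose-0 zero = refl
multichoose-0 (suc m) = refl

multichoose-suc : ∀ m j → multichoose (suc m) j ≡ (j + m) C j
multichoose-suc zero zero = refl
multichoose-suc zero (suc j) = begin
  multichoose 1 j            ≡⟨ multichoose-suc zero j ⟩
  (j + 0) C j                ≡⟨ cong (_C j) (+-identityʳ j) ⟩
  j C j                      ≡⟨ trans (nCn≡1 j) (sym (nCn≡1 (suc j))) ⟩
  suc j C suc j              ≡⟨ cong (_C suc j) (sym (+-identityʳ (suc j))) ⟩
  (suc j + 0) C suc j        ∎
  where open ≡-Reasoning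
multichoose-suc (suc m) zero = refl
multichoose-suc (suc m) (suc j) = begin
  multichoose (suc m) (suc j) + multichoose (suc (suc m)) j
    ≡⟨ cong₂ _+_ (multichoose-suc m (suc j)) (multichoose-suc (suc m) j) ⟩
  (suc j + m) C suc j + (j + suc m) C j
    ≡⟨ cong (λ n → n C suc j + (j + suc m) C j) (sym (+-suc j m)) ⟩
  (j + suc m) C suc j + (j + suc m) C j
    ≡⟨ trans (+-comm _ ((j + suc m) C j)) (sym (C-pascal (j + suc m) j)) ⟩
  suc (j + suc m) C suc j  ∎
  where open ≡-Reasoning

Σ≤-multichoose-suc : ∀ m k (g : ℕ → ℕ) →
  Σ≤ (suc k) (λ j → multichoose (suc m) j * g j)
    ≡ Σ≤ (suc k) (λ j → multichoose m j * g j) + Σ≤ k (λ j → multichoose (suc m) j * g (suc j))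
Σ≤-multichoose-suc m k g = begin
  1 * g 0 + Σ≤ k (λ j → (multichoose m (suc j) + multichoose (suc m) j) * g (suc j))
    ≡⟨ cong (1 * g 0 +_) (trans (Σ<-cong (suc k) (λ j → *-distribʳ-+ (g (suc j)) (multichoose m (suc j)) (multichoose (suc m) j)))
                                (Σ<-+ (suc k) (λ j → multichoose m (suc j) * g (suc j)) (λ j → multichoose (suc m) j * g (suc j)))) ⟩
  1 * g 0 + (S₁ + S₂)
    ≡⟨ sym (+-assoc (1 * g 0) S₁ S₂) ⟩
  1 * g 0 + S₁ + S₂
    ≡⟨ cong (λ z → z * g 0 + S₁ + S₂) (sym (multichoose-0 m)) ⟩
  multichoose m 0 * g 0 + S₁ + S₂  ∎
  where
  open ≡-Reasoning
  S₁ = Σ≤ k (λ j → multichoose m (suc j) * g (suc j))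
  S₂ = Σ≤ k (λ j → multichoose (suc m) j * g (suc j))

mult-[]-∷ : ∀ u b v → mult u (b ∷ v) [] ≡ 0
mult-[]-∷ [] x v = refl
mult-[]-∷ [] y v = refl
mult-[]-∷ (a ∷ u) b v = refl

mult-∷-[] : ∀ a u v → mult (a ∷ u) v [] ≡ 0
mult-∷-[] a u [] = refl
mult-∷-[] a u (b ∷ v) = refl

mult-[]ʳ : ∀ u w → mult u [] w ≡ eqWord u w
mult-[]ʳ [] w = refl
mult-[]ʳ (a ∷ u) w = refl

mult-[] : ∀ u c V → mult u (x^ c ++ y ∷ V) [] ≡ 0
mult-[] u zero V = mult-[]-∷ u y V
mult-[] u (suc c) V = mult-[]-∷ u x _

-- If the first y of the target is that of u, its b leading x's are the i x's of u interleaved with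
-- b ∸ i of the x's of v, in b C i ways; symmetrically if it is that of v.
mult-x^y : ∀ i e b U V W →
  mult (x^ i ++ y ∷ U) (x^ e ++ y ∷ V) (x^ b ++ y ∷ W)
    ≡ (b C i) * leNat b (i + e) * mult U (x^ (i + e ∸ b) ++ y ∷ V) W
      + (b C e) * leNat b (i + e) * mult (x^ (i + e ∸ b) ++ y ∷ U) V W
mult-x^y zero zero zero U V W = refl
mult-x^y zero (suc e) zero U V W = refl
mult-x^y (suc i) zero zero U V W = cong (λ n → mult (x^ n ++ y ∷ U) V W + 0) (sym (+-identityʳ (suc i)))
mult-x^y (suc i) (suc e) zero U V W = refl
mult-x^y zero zero (suc b) U V W = refl
mult-x^y zero (suc e) (suc b) U V W =
  trans (+-identityʳ _) (trans (mult-x^y zero e b U V W)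
    (cong (λ c → (b C 0) * leNat b e * mult U (x^ (e ∸ b) ++ y ∷ V) W + c * mult (x^ (e ∸ b) ++ y ∷ U) V W)
          (sym (C-suc*leNat b e))))
mult-x^y (suc i) zero (suc b) U V W =
  trans (+-identityʳ _) (trans (+-identityʳ _) (trans (mult-x^y i zero b U V W)
    (cong (_+ (b C 0) * leNat b (i + 0) * mult (x^ (i + 0 ∸ b) ++ y ∷ U) V W) (first-term (+-identityʳ i)))))
  where
  first-term : ∀ {n} → n ≡ i → (b C i) * leNat b n * mult U (x^ (n ∸ b) ++ y ∷ V) W
                               ≡ (suc b C suc i) * leNat b n * mult U (x^ (n ∸ b) ++ y ∷ V) W
  first-term refl = cong (_* mult U (x^ (i ∸ b) ++ y ∷ V) W) (sym (C-suc*leNat b i))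
mult-x^y (suc i) (suc e) (suc b) U V W = begin
  mult (x^ i ++ y ∷ U) (x^ (suc e) ++ y ∷ V) w + 0 + (mult (x^ (suc i) ++ y ∷ U) (x^ e ++ y ∷ V) w + 0)
    ≡⟨ cong₂ _+_ (trans (+-identityʳ _) (mult-x^y i (suc e) b U V W))
                 (trans (+-identityʳ _) (trans (mult-x^y (suc i) e b U V W) (cong (split (b C suc i) (b C e)) (sym (+-suc i e))))) ⟩
  split (b C i) (b C suc e) n + split (b C suc i) (b C e) n
    ≡⟨ split-+ (b C i) (b C suc e) (b C suc i) (b C e) (leNat b n) (mult U (x^ (n ∸ b) ++ y ∷ V) W) (mult (x^ (n ∸ b) ++ y ∷ U) V W) ⟩
  split (b C i + b C suc i) (b C e + b C suc e) n
    ≡⟨ cong₂ (λ p q → split p q n) (sym (C-pascal b i)) (sym (C-pascal b e)) ⟩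
  split (suc b C suc i) (suc b C suc e) n  ∎
  where
  open ≡-Reasoning
  w = x^ b ++ y ∷ W
  n = i + suc e
  split : ℕ → ℕ → ℕ → ℕ
  split p q n = p * leNat b n * mult U (x^ (n ∸ b) ++ y ∷ V) W + q * leNat b n * mult (x^ (n ∸ b) ++ y ∷ U) V W
  split-+ : ∀ p q p′ q′ l s t → (p * l * s + q * l * t) + (p′ * l * s + q′ * l * t) ≡ (p + p′) * l * s + (q′ + q) * l * t
  split-+ = solve-∀

mult-y∷y^-x^y : ∀ k e b V W →
  mult (y ∷ y^ k) (x^ e ++ y ∷ V) (x^ b ++ y ∷ W)
    ≡ eqNat b e * mult (y ∷ y^ k) V W + leNat b e * mult (y^ k) (x^ (e ∸ b) ++ y ∷ V) W
mult-y∷y^-x^y k e b V W = begin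
  mult (y ∷ y^ k) (x^ e ++ y ∷ V) (x^ b ++ y ∷ W)
    ≡⟨ mult-x^y zero e b (y^ k) V W ⟩
  1 * leNat b e * mult (y^ k) (x^ (e ∸ b) ++ y ∷ V) W + (b C e) * leNat b e * mult (x^ (e ∸ b) ++ y ∷ y^ k) V W
    ≡⟨ +-comm (1 * leNat b e * mult (y^ k) (x^ (e ∸ b) ++ y ∷ V) W) _ ⟩
  (b C e) * leNat b e * mult (x^ (e ∸ b) ++ y ∷ y^ k) V W + 1 * leNat b e * mult (y^ k) (x^ (e ∸ b) ++ y ∷ V) W
    ≡⟨ cong₂ _+_ (C*leNat-∸ b e (λ t → mult (x^ t ++ y ∷ y^ k) V W))
                 (cong (_* mult (y^ k) (x^ (e ∸ b) ++ y ∷ V) W) (*-identityˡ (leNat b e))) ⟩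
  eqNat b e * mult (y ∷ y^ k) V W + leNat b e * mult (y^ k) (x^ (e ∸ b) ++ y ∷ V) W  ∎
  where open ≡-Reasoning

reaches : ℕ → ℕ → List ℕ → ℕ
reaches j c [] = 0
reaches zero c (b ∷ γ) = eqNat b c
reaches (suc j) c (b ∷ γ) = leNat b c * reaches j (c ∸ b) γ

mult-y^-wordOf : ∀ k c ds γ →
  mult (y^ k) (wordOf (c ∷ ds)) (wordOf γ)
    ≡ Σ≤ k (λ j → reaches j c γ * mult (y^ (k ∸ j)) (wordOf ds) (wordOf (drop (suc j) γ)))
mult-y^-wordOf k c ds [] =
  trans (cong (λ v → mult (y^ k) v []) (wordOf-∷ c ds))
        (trans (mult-[] (y^ k) c (wordOf ds)) (sym (Σ<-0 (suc k) _ (λ _ → refl))))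
mult-y^-wordOf zero c ds (b ∷ γ) =
  trans (cong₂ eqWord (wordOf-∷ c ds) (wordOf-∷ b γ))
        (trans (eqWord-x^y c b (wordOf ds) (wordOf γ)) (sym (+-identityʳ _)))
mult-y^-wordOf (suc k) c ds (b ∷ γ) = begin
  mult (y^ (suc k)) (wordOf (c ∷ ds)) (wordOf (b ∷ γ))
    ≡⟨ cong₂ (mult (y^ (suc k))) (wordOf-∷ c ds) (wordOf-∷ b γ) ⟩
  mult (y ∷ y^ k) (x^ c ++ y ∷ wordOf ds) (x^ b ++ y ∷ wordOf γ)
    ≡⟨ mult-y∷y^-x^y k c b (wordOf ds) (wordOf γ) ⟩
  first + leNat b c * mult (y^ k) (x^ (c ∸ b) ++ y ∷ wordOf ds) (wordOf γ)
    ≡⟨ cong (λ v → first + leNat b c * mult (y^ k) v (wordOf γ)) (sym (wordOf-∷ (c ∸ b) ds)) ⟩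
  first + leNat b c * mult (y^ k) (wordOf ((c ∸ b) ∷ ds)) (wordOf γ)
    ≡⟨ cong (λ t → first + leNat b c * t) (mult-y^-wordOf k (c ∸ b) ds γ) ⟩
  first + leNat b c * Σ≤ k f
    ≡⟨ cong (first +_) (trans (Σ<-*ˡ (leNat b c) (suc k) f) (Σ<-cong (suc k) (λ j → sym (*-assoc (leNat b c) (reaches j (c ∸ b) γ) (M j))))) ⟩
  Σ≤ (suc k) (λ j → reaches j c (b ∷ γ) * mult (y^ (suc k ∸ j)) (wordOf ds) (wordOf (drop (suc j) (b ∷ γ))))  ∎
  where
  open ≡-Reasoning
  first = eqNat b c * mult (y^ (suc k)) (wordOf ds) (wordOf γ)
  M : ℕ → ℕ
  M j = mult (y^ (k ∸ j)) (wordOf ds) (wordOf (drop (suc j) γ))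
  f = λ j → reaches j (c ∸ b) γ * M j

zeroPrefix : ℕ → List ℕ → ℕ
zeroPrefix zero γ = 1
zeroPrefix (suc n) [] = 0
zeroPrefix (suc n) (b ∷ γ) = eqNat b 0 * zeroPrefix n γ

mult-y^-zeros : ∀ m k ds γ →
  mult (y^ k) (wordOf (replicate m 0 ++ ds)) (wordOf γ)
    ≡ Σ≤ k (λ j → multichoose m j * zeroPrefix (m + j) γ * mult (y^ (k ∸ j)) (wordOf ds) (wordOf (drop (m + j) γ)))
mult-y^-zeros zero k ds γ =
  sym (trans (cong₂ _+_ (+-identityʳ _) (Σ<-0 k _ (λ _ → refl))) (+-identityʳ _))
mult-y^-zeros (suc m) k ds [] =
  trans (mult-[] (y^ k) 0 (wordOf (replicate m 0 ++ ds)))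
        (sym (Σ<-0 (suc k) _ (λ j → cong (_* mult (y^ (k ∸ j)) (wordOf ds) (wordOf [])) (*-zeroʳ (multichoose (suc m) j)))))
mult-y^-zeros (suc m) zero ds (b ∷ β) = begin
  eqWord (y ∷ wordOf R) (wordOf (b ∷ β))
    ≡⟨ cong (eqWord (y ∷ wordOf R)) (wordOf-∷ b β) ⟩
  eqWord (x^ 0 ++ y ∷ wordOf R) (x^ b ++ y ∷ wordOf β)
    ≡⟨ eqWord-x^y 0 b (wordOf R) (wordOf β) ⟩
  eqNat b 0 * eqWord (wordOf R) (wordOf β)
    ≡⟨ cong (eqNat b 0 *_) (mult-y^-zeros m 0 ds β) ⟩
  eqNat b 0 * (multichoose m 0 * Z * M + 0)
    ≡⟨ cong (λ c → eqNat b 0 * (c * Z * M + 0)) (multichoose-0 m) ⟩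
  eqNat b 0 * (1 * Z * M + 0)
    ≡⟨ rearrange (eqNat b 0) Z M ⟩
  1 * (eqNat b 0 * Z) * M + 0  ∎
  where
  open ≡-Reasoning
  R = replicate m 0 ++ ds
  Z = zeroPrefix (m + 0) β
  M = eqWord (wordOf ds) (wordOf (drop (m + 0) β))
  rearrange : ∀ e z t → e * (1 * z * t + 0) ≡ 1 * (e * z) * t + 0
  rearrange = solve-∀
mult-y^-zeros (suc m) (suc k) ds (b ∷ β) = begin
  mult (y ∷ y^ k) (wordOf (0 ∷ R)) (wordOf (b ∷ β))
    ≡⟨ cong (mult (y ∷ y^ k) (wordOf (0 ∷ R))) (wordOf-∷ b β) ⟩
  mult (y ∷ y^ k) (x^ 0 ++ y ∷ wordOf R) (x^ b ++ y ∷ wordOf β)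
    ≡⟨ mult-y∷y^-x^y k 0 b (wordOf R) (wordOf β) ⟩
  eqNat b 0 * mult (y^ (suc k)) (wordOf R) (wordOf β) + leNat b 0 * mult (y^ k) (x^ (0 ∸ b) ++ y ∷ wordOf R) (wordOf β)
    ≡⟨ cong₂ (λ l t → eqNat b 0 * mult (y^ (suc k)) (wordOf R) (wordOf β) + l * mult (y^ k) (x^ t ++ y ∷ wordOf R) (wordOf β))
             (leNat-0 b) (0∸n≡0 b) ⟩
  eqNat b 0 * mult (y^ (suc k)) (wordOf R) (wordOf β) + eqNat b 0 * mult (y^ k) (wordOf (0 ∷ R)) (wordOf β)
    ≡⟨ sym (*-distribˡ-+ (eqNat b 0) _ _) ⟩
  eqNat b 0 * (mult (y^ (suc k)) (wordOf R) (wordOf β) + mult (y^ k) (wordOf (0 ∷ R)) (wordOf β))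
    ≡⟨ cong (eqNat b 0 *_) (cong₂ _+_ fewer-zeros shorter-y^) ⟩
  eqNat b 0 * (Σ≤ (suc k) (λ j → multichoose m j * g j) + Σ≤ k (λ j → multichoose (suc m) j * g (suc j)))
    ≡⟨ cong (eqNat b 0 *_) (sym (Σ≤-multichoose-suc m k g)) ⟩
  eqNat b 0 * Σ≤ (suc k) (λ j → multichoose (suc m) j * g j)
    ≡⟨ trans (Σ<-*ˡ (eqNat b 0) (suc (suc k)) (λ j → multichoose (suc m) j * g j))
             (Σ<-cong (suc (suc k)) (λ j → rearrange (eqNat b 0) (multichoose (suc m) j) (zeroPrefix (m + j) β) (M (m + j) (suc k ∸ j)))) ⟩
  Σ≤ (suc k) (λ j → multichoose (suc m) j * zeroPrefix (suc m + j) (b ∷ β) * M (m + j) (suc k ∸ j))  ∎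
  where
  open ≡-Reasoning
  R = replicate m 0 ++ ds
  M : ℕ → ℕ → ℕ
  M p q = mult (y^ q) (wordOf ds) (wordOf (drop p β))
  g : ℕ → ℕ
  g j = zeroPrefix (m + j) β * M (m + j) (suc k ∸ j)
  fewer-zeros : mult (y^ (suc k)) (wordOf R) (wordOf β) ≡ Σ≤ (suc k) (λ j → multichoose m j * g j)
  fewer-zeros = trans (mult-y^-zeros m (suc k) ds β)
                      (Σ<-cong (suc (suc k)) (λ j → *-assoc (multichoose m j) (zeroPrefix (m + j) β) (M (m + j) (suc k ∸ j))))
  shorter-y^ : mult (y^ k) (wordOf (0 ∷ R)) (wordOf β) ≡ Σ≤ k (λ j → multichoose (suc m) j * g (suc j))
  shorter-y^ = trans (mult-y^-zeros (suc m) k ds β) (Σ<-cong (suc k) (λ j →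
    trans (*-assoc (multichoose (suc m) j) (zeroPrefix (suc m + j) β) (M (suc m + j) (k ∸ j)))
          (cong (λ p → multichoose (suc m) j * (zeroPrefix p β * M p (k ∸ j))) (sym (+-suc m j)))))
  rearrange : ∀ e c z t → e * (c * (z * t)) ≡ c * (e * z) * t
  rearrange = solve-∀

mult-y^-y^ : ∀ k m w → mult (y^ k) (y^ m) w ≡ ((k + m) C k) * eqWord (y^ (k + m)) w
mult-y^-y^ zero m w = sym (+-identityʳ _)
mult-y^-y^ (suc k) zero w = sym (begin
  ((suc k + 0) C suc k) * eqWord (y^ (suc k + 0)) w
    ≡⟨ cong (λ n → (n C suc k) * eqWord (y^ n) w) (+-identityʳ (suc k)) ⟩
  (suc k C suc k) * eqWord (y^ (suc k)) w
    ≡⟨ cong (_* eqWord (y^ (suc k)) w) (nCn≡1 (suc k)) ⟩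
  1 * eqWord (y^ (suc k)) w
    ≡⟨ +-identityʳ _ ⟩
  eqWord (y^ (suc k)) w  ∎)
  where open ≡-Reasoning
mult-y^-y^ (suc k) (suc m) [] = sym (*-zeroʳ ((suc k + suc m) C suc k))
mult-y^-y^ (suc k) (suc m) (c ∷ w) = begin
  eqLetter y c * mult (y^ k) (y^ (suc m)) w + eqLetter y c * mult (y^ (suc k)) (y^ m) w
    ≡⟨ cong₂ (λ p q → eqLetter y c * p + eqLetter y c * q) (mult-y^-y^ k (suc m) w)
             (trans (mult-y^-y^ (suc k) m w) (cong (λ n → (n C suc k) * eqWord (y^ n) w) (sym (+-suc k m)))) ⟩
  eqLetter y c * ((n C k) * t) + eqLetter y c * ((n C suc k) * t)
    ≡⟨ factor (eqLetter y c) (n C k) (n C suc k) t ⟩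
  (n C k + n C suc k) * (eqLetter y c * t)
    ≡⟨ cong (_* (eqLetter y c * t)) (sym (C-pascal n k)) ⟩
  (suc n C suc k) * (eqLetter y c * t)  ∎
  where
  open ≡-Reasoning
  n = k + suc m
  t = eqWord (y^ n) w
  factor : ∀ l p q t → l * (p * t) + l * (q * t) ≡ (p + q) * (l * t)
  factor = solve-∀

fitsIn : ℕ → ℕ → List ℕ → ℕ
fitsIn zero c γ = 1
fitsIn (suc m) c [] = 0
fitsIn (suc m) c (b ∷ γ) = leNat b c * fitsIn m (c ∸ b) γ

remainder : ℕ → ℕ → List ℕ → ℕ
remainder zero c γ = c
remainder (suc m) c [] = c
remainder (suc m) c (b ∷ γ) = remainder m (c ∸ b) γ

mult-x^y^-wordOf : ∀ i k e ds b β →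
  mult (x^ i ++ y^ (suc k)) (wordOf (e ∷ ds)) (wordOf (b ∷ β))
    ≡ (b C i) * leNat b (i + e) * mult (y^ k) (wordOf ((i + e ∸ b) ∷ ds)) (wordOf β)
      + (b C e) * leNat b (i + e) * mult (x^ (i + e ∸ b) ++ y^ (suc k)) (wordOf ds) (wordOf β)
mult-x^y^-wordOf i k e ds b β =
  trans (cong₂ (mult (x^ i ++ y^ (suc k))) (wordOf-∷ e ds) (wordOf-∷ b β))
  (trans (mult-x^y i e b (y^ k) (wordOf ds) (wordOf β))
         (cong (λ v → (b C i) * leNat b (i + e) * mult (y^ k) v (wordOf β) + second) (sym (wordOf-∷ (i + e ∸ b) ds))))
  where second = (b C e) * leNat b (i + e) * mult (x^ (i + e ∸ b) ++ y^ (suc k)) (wordOf ds) (wordOf β)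

mult-x^y^-zeros : ∀ m i k ds β →
  mult (x^ i ++ y^ (suc k)) (wordOf (replicate m 0 ++ ds)) (wordOf β)
    ≡ Σ< m (λ j → reaches j i β * mult (y^ k) (wordOf (replicate (m ∸ j) 0 ++ ds)) (wordOf (drop (suc j) β)))
      + fitsIn m i β * mult (x^ (remainder m i β) ++ y^ (suc k)) (wordOf ds) (wordOf (drop m β))
mult-x^y^-zeros zero i k ds β = sym (+-identityʳ _)
mult-x^y^-zeros (suc m) i k ds [] =
  trans (mult-[] (x^ i ++ y^ (suc k)) 0 (wordOf (replicate m 0 ++ ds)))
        (sym (trans (+-identityʳ _) (Σ<-0 (suc m) _ (λ _ → refl))))
mult-x^y^-zeros (suc m) i k ds (b ∷ β) = begin
  mult (x^ i ++ y^ (suc k)) (wordOf (0 ∷ R)) (wordOf (b ∷ β))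
    ≡⟨ mult-x^y^-wordOf i k 0 R b β ⟩
  (b C i) * leNat b (i + 0) * mult (y^ k) (wordOf ((i + 0 ∸ b) ∷ R)) (wordOf β)
    + 1 * leNat b (i + 0) * mult (x^ (i + 0 ∸ b) ++ y^ (suc k)) (wordOf R) (wordOf β)
    ≡⟨ cong (λ n → (b C i) * leNat b n * mult (y^ k) (wordOf ((n ∸ b) ∷ R)) (wordOf β)
                   + 1 * leNat b n * mult (x^ (n ∸ b) ++ y^ (suc k)) (wordOf R) (wordOf β)) (+-identityʳ i) ⟩
  (b C i) * leNat b i * mult (y^ k) (wordOf ((i ∸ b) ∷ R)) (wordOf β)
    + 1 * leNat b i * mult (x^ (i ∸ b) ++ y^ (suc k)) (wordOf R) (wordOf β)
    ≡⟨ cong₂ _+_ (C*leNat-∸ b i (λ t → mult (y^ k) (wordOf (t ∷ R)) (wordOf β)))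
                 (trans (cong (_* mult (x^ (i ∸ b) ++ y^ (suc k)) (wordOf R) (wordOf β)) (*-identityˡ (leNat b i)))
                        (cong (leNat b i *_) (mult-x^y^-zeros m (i ∸ b) k ds β))) ⟩
  first + leNat b i * (Σ< m s + fitsIn m (i ∸ b) β * t)
    ≡⟨ cong (first +_) (trans (*-distribˡ-+ (leNat b i) (Σ< m s) _)
         (cong₂ _+_ (trans (Σ<-*ˡ (leNat b i) m s) (Σ<-cong m (λ j → sym (*-assoc (leNat b i) (reaches j (i ∸ b) β) (s′ j)))))
                    (sym (*-assoc (leNat b i) (fitsIn m (i ∸ b) β) t)))) ⟩
  first + (Σ< m (λ j → leNat b i * reaches j (i ∸ b) β * s′ j) + leNat b i * fitsIn m (i ∸ b) β * t)
    ≡⟨ sym (+-assoc first _ _) ⟩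
  first + Σ< m (λ j → leNat b i * reaches j (i ∸ b) β * s′ j) + leNat b i * fitsIn m (i ∸ b) β * t  ∎
  where
  open ≡-Reasoning
  R = replicate m 0 ++ ds
  first = eqNat b i * mult (y^ k) (wordOf (0 ∷ R)) (wordOf β)
  s′ : ℕ → ℕ
  s′ j = mult (y^ k) (wordOf (replicate (m ∸ j) 0 ++ ds)) (wordOf (drop (suc j) β))
  s : ℕ → ℕ
  s j = reaches j (i ∸ b) β * s′ j
  t = mult (x^ (remainder m (i ∸ b) β) ++ y^ (suc k)) (wordOf ds) (wordOf (drop m β))

-- Support of a shuffle

occ : Letter → Word → ℕ
occ ℓ [] = 0
occ ℓ (a ∷ w) = eqLetter a ℓ + occ ℓ w

occ-++ : ∀ ℓ u v → occ ℓ (u ++ v) ≡ occ ℓ u + occ ℓ v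
occ-++ ℓ [] v = refl
occ-++ ℓ (a ∷ u) v = trans (cong (eqLetter a ℓ +_) (occ-++ ℓ u v)) (sym (+-assoc (eqLetter a ℓ) _ _))

occ-x-x^ : ∀ t → occ x (x^ t) ≡ t
occ-x-x^ zero = refl
occ-x-x^ (suc t) = cong suc (occ-x-x^ t)

occ-y-x^ : ∀ t → occ y (x^ t) ≡ 0
occ-y-x^ zero = refl
occ-y-x^ (suc t) = occ-y-x^ t

occ-x-y^ : ∀ t → occ x (y^ t) ≡ 0
occ-x-y^ zero = refl
occ-x-y^ (suc t) = occ-x-y^ t

occ-y-y^ : ∀ t → occ y (y^ t) ≡ t
occ-y-y^ zero = refl
occ-y-y^ (suc t) = cong suc (occ-y-y^ t)

occ-x-xy : ∀ a r → occ x (xy a r) ≡ a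
occ-x-xy a r = trans (occ-++ x (x^ a) (y^ r)) (trans (cong₂ _+_ (occ-x-x^ a) (occ-x-y^ r)) (+-identityʳ a))

occ-y-xy : ∀ a r → occ y (xy a r) ≡ r
occ-y-xy a r = trans (occ-++ y (x^ a) (y^ r)) (cong₂ _+_ (occ-y-x^ a) (occ-y-y^ r))

occ-x-wordOf : ∀ β → occ x (wordOf β) ≡ sum β
occ-x-wordOf [] = refl
occ-x-wordOf (b ∷ β) =
  trans (cong (occ x) (wordOf-∷ b β)) (trans (occ-++ x (x^ b) (y ∷ wordOf β)) (cong₂ _+_ (occ-x-x^ b) (occ-x-wordOf β)))

occ-y-wordOf : ∀ β → occ y (wordOf β) ≡ length β
occ-y-wordOf [] = refl
occ-y-wordOf (b ∷ β) =
  trans (cong (occ y) (wordOf-∷ b β)) (trans (occ-++ y (x^ b) (y ∷ wordOf β)) (cong₂ _+_ (occ-y-x^ b) (cong suc (occ-y-wordOf β))))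

EndsInY : Word → Set
EndsInY [] = ⊤
EndsInY (c ∷ []) = c ≡ y
EndsInY (c ∷ d ∷ w) = EndsInY (d ∷ w)

EndsInY-tail : ∀ a u → EndsInY (a ∷ u) → EndsInY u
EndsInY-tail a [] _ = tt
EndsInY-tail a (d ∷ u) p = p

EndsInY-∷ : ∀ c w → w ≢ [] → EndsInY w → EndsInY (c ∷ w)
EndsInY-∷ c [] w≢[] _ = ⊥-elim (w≢[] refl)
EndsInY-∷ c (d ∷ w) _ p = p

EndsInY-++y : ∀ u w → EndsInY w → EndsInY (u ++ y ∷ w)
EndsInY-++y [] [] _ = refl
EndsInY-++y [] (d ∷ w) p = p
EndsInY-++y (c ∷ u) w p = EndsInY-∷ c (u ++ y ∷ w) (nonempty u) (EndsInY-++y u w p)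
  where
  nonempty : ∀ u → u ++ y ∷ w ≢ []
  nonempty [] ()
  nonempty (_ ∷ _) ()

EndsInY-wordOf : ∀ β → EndsInY (wordOf β)
EndsInY-wordOf [] = tt
EndsInY-wordOf (b ∷ β) = subst EndsInY (sym (wordOf-∷ b β)) (EndsInY-++y (x^ b) (wordOf β) (EndsInY-wordOf β))

¬EndsInY-++x : ∀ u t → ¬ EndsInY (u ++ x ∷ x^ t)
¬EndsInY-++x [] zero ()
¬EndsInY-++x [] (suc t) p = ¬EndsInY-++x [] t p
¬EndsInY-++x (c ∷ u) t p = ¬EndsInY-++x u t (EndsInY-tail c (u ++ x ∷ x^ t) p)

eqWord≢0⇒≡ : ∀ u w → eqWord u w ≢ 0 → u ≡ w
eqWord≢0⇒≡ u w ≢0 with u ≟W w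
... | yes u≡w = u≡w
... | no u≢w = ⊥-elim (≢0 (eqWord-≢ u w u≢w))

eqLetter≢0⇒≡ : ∀ a c → eqLetter a c ≢ 0 → a ≡ c
eqLetter≢0⇒≡ x x _ = refl
eqLetter≢0⇒≡ x y ≢0 = ⊥-elim (≢0 refl)
eqLetter≢0⇒≡ y x ≢0 = ⊥-elim (≢0 refl)
eqLetter≢0⇒≡ y y _ = refl

+≢0 : ∀ m n → m + n ≢ 0 → m ≢ 0 ⊎ n ≢ 0
+≢0 zero n ≢0 = inj₂ ≢0
+≢0 (suc m) n _ = inj₁ (λ ())

*≢0 : ∀ m n → m * n ≢ 0 → m ≢ 0 × n ≢ 0
*≢0 m n ≢0 = (λ { refl → ≢0 refl }) , (λ { refl → ≢0 (*-zeroʳ m) })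

Compatible : Word → Word → Word → Set
Compatible u v w = (∀ ℓ → occ ℓ w ≡ occ ℓ u + occ ℓ v) × (EndsInY u → EndsInY v → EndsInY w)

mult-support : ∀ u v w → mult u v w ≢ 0 → Compatible u v w
mult-support [] v w ≢0 with eqWord≢0⇒≡ v w ≢0
... | refl = (λ _ → refl) , (λ _ ev → ev)
mult-support (a ∷ u) [] w ≢0 with eqWord≢0⇒≡ (a ∷ u) w ≢0
... | refl = (λ _ → sym (+-identityʳ _)) , (λ eu _ → eu)
mult-support (a ∷ u) (b ∷ v) [] ≢0 = ⊥-elim (≢0 refl)
mult-support (a ∷ u) (b ∷ v) (c ∷ w) ≢0 with +≢0 (eqLetter a c * mult u (b ∷ v) w) _ ≢0
... | inj₁ ≢0ˡ with *≢0 (eqLetter a c) _ ≢0ˡ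
...   | a≈c , rest with eqLetter≢0⇒≡ a c a≈c | mult-support u (b ∷ v) w rest
...     | refl | occ≡ , ends =
  (λ ℓ → trans (cong (eqLetter a ℓ +_) (occ≡ ℓ)) (sym (+-assoc (eqLetter a ℓ) _ _))) ,
  (λ eu ev → EndsInY-∷ a w (λ { refl → rest (mult-[]-∷ u b v) }) (ends (EndsInY-tail a u eu) ev))
mult-support (a ∷ u) (b ∷ v) (c ∷ w) ≢0 | inj₂ ≢0ʳ with *≢0 (eqLetter b c) _ ≢0ʳ
...   | b≈c , rest with eqLetter≢0⇒≡ b c b≈c | mult-support (a ∷ u) v w rest
...     | refl | occ≡ , ends =
  (λ ℓ → trans (cong (eqLetter b ℓ +_) (occ≡ ℓ)) (+-exchange (eqLetter b ℓ) (occ ℓ (a ∷ u)) (occ ℓ v))) ,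
  (λ eu ev → EndsInY-∷ b w (λ { refl → rest (mult-∷-[] a u v) }) (ends eu (EndsInY-tail b v ev)))
  where
  +-exchange : ∀ p q r → p + (q + r) ≡ q + (p + r)
  +-exchange = solve-∀

wordOf++x^-decomposition : ∀ w → Σ[ β ∈ List ℕ ] Σ[ t ∈ ℕ ] wordOf β ++ x^ t ≡ w
wordOf++x^-decomposition [] = [] , 0 , refl
wordOf++x^-decomposition (y ∷ w) with wordOf++x^-decomposition w
... | β , t , e = 0 ∷ β , t , cong (y ∷_) e
wordOf++x^-decomposition (x ∷ w) with wordOf++x^-decomposition w
... | [] , t , e = [] , suc t , cong (x ∷_) e
... | b ∷ β , t , e = suc b ∷ β , t , cong (x ∷_) e

module _ (u v : Word) (eu : EndsInY u) (ev : EndsInY v) {n m : ℕ}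
         (occ-y≡ : occ y u + occ y v ≡ n) (occ-x≡ : occ x u + occ x v ≡ m) where

  mult-wordOf++x^≢0 : ∀ β t → mult u v (wordOf β ++ x^ t) ≢ 0 → t ≡ 0 × length β ≡ n × sum β ≡ m
  mult-wordOf++x^≢0 β t ≢0 with mult-support u v (wordOf β ++ x^ t) ≢0
  ... | occ≡ , ends = t≡0 , length≡ , sum≡
    where
    no-trailing-x : ∀ t → EndsInY (wordOf β ++ x^ t) → t ≡ 0
    no-trailing-x zero _ = refl
    no-trailing-x (suc t) e = ⊥-elim (¬EndsInY-++x (wordOf β) t e)
    t≡0 = no-trailing-x t (ends eu ev)
    length≡ : length β ≡ n
    length≡ = begin
      length β
        ≡⟨ sym (trans (occ-++ y (wordOf β) (x^ t)) (trans (cong₂ _+_ (occ-y-wordOf β) (occ-y-x^ t)) (+-identityʳ _))) ⟩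
      occ y (wordOf β ++ x^ t)
        ≡⟨ trans (occ≡ y) occ-y≡ ⟩
      n  ∎
      where open ≡-Reasoning
    sum≡ : sum β ≡ m
    sum≡ = begin
      sum β                                ≡⟨ sym (+-identityʳ (sum β)) ⟩
      sum β + 0                            ≡⟨ cong₂ _+_ (sym (occ-x-wordOf β)) (sym (trans (occ-x-x^ t) t≡0)) ⟩
      occ x (wordOf β) + occ x (x^ t)      ≡⟨ sym (occ-++ x (wordOf β) (x^ t)) ⟩
      occ x (wordOf β ++ x^ t)             ≡⟨ trans (occ≡ x) occ-x≡ ⟩
      m                                    ∎
      where open ≡-Reasoning

  mult-wordOf++x^-vanishes : ∀ β t → ¬ (t ≡ 0 × length β ≡ n × sum β ≡ m) → mult u v (wordOf β ++ x^ t) ≡ 0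
  mult-wordOf++x^-vanishes β t ¬shape with mult u v (wordOf β ++ x^ t) ≟ 0
  ... | yes ≡0 = ≡0
  ... | no ≢0 = ⊥-elim (¬shape (mult-wordOf++x^≢0 β t ≢0))

  mult-wordOf++x^ : ∀ (F : List ℕ → ℕ) β t → (length β ≡ n → sum β ≡ m → mult u v (wordOf β) ≡ F β) →
                    mult u v (wordOf β ++ x^ t) ≡ eqNat t 0 * (eqNat (length β) n * (eqNat (sum β) m * F β))
  mult-wordOf++x^ F β t shape⇒F with t ≟ 0 | length β ≟ n | sum β ≟ m
  ... | yes refl | yes length≡ | yes sum≡ = begin
    mult u v (wordOf β ++ [])
      ≡⟨ cong (mult u v) (++-identityʳ (wordOf β)) ⟩
    mult u v (wordOf β)
      ≡⟨ shape⇒F length≡ sum≡ ⟩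
    F β
      ≡⟨ sym (trans (+-identityʳ _) (trans (+-identityʳ _) (+-identityʳ _))) ⟩
    1 * (1 * (1 * F β))
      ≡⟨ cong₂ (λ p q → 1 * (p * (q * F β))) (sym (≡⇒eqNat≡1 length≡)) (sym (≡⇒eqNat≡1 sum≡)) ⟩
    1 * (eqNat (length β) n * (eqNat (sum β) m * F β))  ∎
    where open ≡-Reasoning
  ... | no t≢0 | _ | _ =
    trans (mult-wordOf++x^-vanishes β t (t≢0 ∘ proj₁)) (sym (cong (_* _) (eqNat-≢ t 0 t≢0)))
  ... | yes refl | no length≢ | _ =
    trans (mult-wordOf++x^-vanishes β 0 (length≢ ∘ proj₁ ∘ proj₂))
          (sym (cong (λ p → 1 * (p * (eqNat (sum β) m * F β))) (eqNat-≢ _ n length≢)))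
  ... | yes refl | yes _ | no sum≢ =
    trans (mult-wordOf++x^-vanishes β 0 (sum≢ ∘ proj₂ ∘ proj₂))
          (sym (trans (cong (λ p → 1 * (eqNat (length β) n * (p * F β))) (eqNat-≢ _ m sum≢))
                      (cong (1 *_) (*-zeroʳ (eqNat (length β) n)))))

eqList : List ℕ → List ℕ → ℕ
eqList [] [] = 1
eqList [] (_ ∷ _) = 0
eqList (_ ∷ _) [] = 0
eqList (a ∷ α) (b ∷ β) = eqNat b a * eqList α β

eqWord-wordOf-wordOf++x^ : ∀ α β t → eqWord (wordOf α) (wordOf β ++ x^ t) ≡ eqNat t 0 * eqList α β
eqWord-wordOf-wordOf++x^ [] [] zero = refl
eqWord-wordOf-wordOf++x^ [] [] (suc t) = refl
eqWord-wordOf-wordOf++x^ [] (b ∷ β) t =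
  trans (cong (λ w → eqWord [] (w ++ x^ t)) (wordOf-∷ b β)) (trans (nonempty b) (sym (*-zeroʳ (eqNat t 0))))
  where
  nonempty : ∀ b → eqWord [] ((x^ b ++ y ∷ wordOf β) ++ x^ t) ≡ 0
  nonempty zero = refl
  nonempty (suc b) = refl
eqWord-wordOf-wordOf++x^ (a ∷ α) [] t =
  trans (cong (λ w → eqWord w (x^ t)) (wordOf-∷ a α)) (trans (has-y a t) (sym (*-zeroʳ (eqNat t 0))))
  where
  has-y : ∀ a t → eqWord (x^ a ++ y ∷ wordOf α) (x^ t) ≡ 0
  has-y zero zero = refl
  has-y zero (suc t) = refl
  has-y (suc a) zero = refl
  has-y (suc a) (suc t) = trans (+-identityʳ _) (has-y a t)
eqWord-wordOf-wordOf++x^ (a ∷ α) (b ∷ β) t = begin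
  eqWord (wordOf (a ∷ α)) (wordOf (b ∷ β) ++ x^ t)
    ≡⟨ cong₂ eqWord (wordOf-∷ a α) (trans (cong (_++ x^ t) (wordOf-∷ b β)) (++-assoc (x^ b) (y ∷ wordOf β) (x^ t))) ⟩
  eqWord (x^ a ++ y ∷ wordOf α) (x^ b ++ y ∷ wordOf β ++ x^ t)
    ≡⟨ eqWord-x^y a b (wordOf α) (wordOf β ++ x^ t) ⟩
  eqNat b a * eqWord (wordOf α) (wordOf β ++ x^ t)
    ≡⟨ cong (eqNat b a *_) (eqWord-wordOf-wordOf++x^ α β t) ⟩
  eqNat b a * (eqNat t 0 * eqList α β)
    ≡⟨ x∙yz≈y∙xz (eqNat b a) (eqNat t 0) (eqList α β) ⟩
  eqNat t 0 * (eqNat b a * eqList α β)  ∎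
  where
  open ≡-Reasoning

ΣL-comps-eqList : ∀ n m (f : List ℕ → ℕ) β →
  ΣL (comps n m) (λ α → f α * eqList α β) ≡ eqNat (length β) n * (eqNat (sum β) m * f β)
ΣL-comps-eqList zero zero f [] = trans (+-identityʳ _) (trans (*-identityʳ (f [])) (sym (trans (*-identityˡ _) (*-identityˡ _))))
ΣL-comps-eqList zero zero f (b ∷ β) = trans (+-identityʳ _) (*-zeroʳ (f []))
ΣL-comps-eqList zero (suc m) f [] = refl
ΣL-comps-eqList zero (suc m) f (b ∷ β) = refl
ΣL-comps-eqList (suc n) m f [] =
  trans (ΣL-concatMap (λ i → map (i ∷_) (comps n (m ∸ i))) (range 0 m) _)
        (ΣL-0 (range 0 m) (λ i → trans (ΣL-map (i ∷_) (comps n (m ∸ i)) _) (ΣL-0 (comps n (m ∸ i)) (λ α → *-zeroʳ (f (i ∷ α))))))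
ΣL-comps-eqList (suc n) m f (b ∷ β) = begin
  ΣL (concatMap (λ i → map (i ∷_) (comps n (m ∸ i))) (range 0 m)) (λ α → f α * eqList α (b ∷ β))
    ≡⟨ ΣL-concatMap (λ i → map (i ∷_) (comps n (m ∸ i))) (range 0 m) _ ⟩
  ΣL (range 0 m) (λ i → ΣL (map (i ∷_) (comps n (m ∸ i))) (λ α → f α * eqList α (b ∷ β)))
    ≡⟨ trans (sumR≡Σ< 0 m (λ i → ΣL (map (i ∷_) (comps n (m ∸ i))) (λ α → f α * eqList α (b ∷ β))))
             (Σ<-cong (suc m) (λ i → trans (ΣL-map (i ∷_) (comps n (m ∸ i)) (λ α → f α * eqList α (b ∷ β))) (first-entry i))) ⟩
  Σ≤ m (λ i → eqNat b i * (eqNat (length β) n * (eqNat (sum β) (m ∸ i) * f (i ∷ β))))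
    ≡⟨ Σ≤-eqNat m b (λ i → eqNat (length β) n * (eqNat (sum β) (m ∸ i) * f (i ∷ β))) ⟩
  leNat b m * (eqNat (length β) n * (eqNat (sum β) (m ∸ b) * f (b ∷ β)))
    ≡⟨ regroup (leNat b m) (eqNat (length β) n) (eqNat (sum β) (m ∸ b)) (f (b ∷ β)) ⟩
  eqNat (length β) n * (leNat b m * eqNat (sum β) (m ∸ b) * f (b ∷ β))
    ≡⟨ cong (λ e → eqNat (length β) n * (e * f (b ∷ β))) (leNat*eqNat-∸ b (sum β) m) ⟩
  eqNat (length β) n * (eqNat (b + sum β) m * f (b ∷ β))  ∎
  where
  open ≡-Reasoning
  regroup : ∀ p q r s → p * (q * (r * s)) ≡ q * (p * r * s)
  regroup = solve-∀
  first-entry : ∀ i → ΣL (comps n (m ∸ i)) (λ α → f (i ∷ α) * eqList (i ∷ α) (b ∷ β))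
                      ≡ eqNat b i * (eqNat (length β) n * (eqNat (sum β) (m ∸ i) * f (i ∷ β)))
  first-entry i = begin
    ΣL (comps n (m ∸ i)) (λ α → f (i ∷ α) * (eqNat b i * eqList α β))
      ≡⟨ ΣL-cong (comps n (m ∸ i)) (λ α → x∙yz≈y∙xz (f (i ∷ α)) (eqNat b i) (eqList α β)) ⟩
    ΣL (comps n (m ∸ i)) (λ α → eqNat b i * (f (i ∷ α) * eqList α β))
      ≡⟨ sym (ΣL-*ˡ (eqNat b i) (comps n (m ∸ i)) _) ⟩
    eqNat b i * ΣL (comps n (m ∸ i)) (λ α → f (i ∷ α) * eqList α β)
      ≡⟨ cong (eqNat b i *_) (ΣL-comps-eqList n (m ∸ i) (λ α → f (i ∷ α)) β) ⟩
    eqNat b i * (eqNat (length β) n * (eqNat (sum β) (m ∸ i) * f (i ∷ β)))  ∎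

coeff-rhs : ∀ a b₁ b₂ r s₁ s₂ β t →
  coeff (rhs a b₁ b₂ r s₁ s₂) (wordOf β ++ x^ t)
    ≡ eqNat t 0 * (eqNat (length β) (r + s₁ + s₂) * (eqNat (sum β) (a + b₁ + b₂) * coef a b₁ b₂ r s₁ s₂ β))
coeff-rhs a b₁ b₂ r s₁ s₂ β t = begin
  coeff (rhs a b₁ b₂ r s₁ s₂) w
    ≡⟨ coeff-map (λ α → coef′ α , wordOf α) (comps n m) w ⟩
  ΣL (comps n m) (λ α → coef′ α * eqWord (wordOf α) w)
    ≡⟨ ΣL-cong (comps n m) (λ α → cong (coef′ α *_) (eqWord-wordOf-wordOf++x^ α β t)) ⟩
  ΣL (comps n m) (λ α → coef′ α * (eqNat t 0 * eqList α β))
    ≡⟨ ΣL-cong (comps n m) (λ α → x∙yz≈y∙xz (coef′ α) (eqNat t 0) (eqList α β)) ⟩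
  ΣL (comps n m) (λ α → eqNat t 0 * (coef′ α * eqList α β))
    ≡⟨ sym (ΣL-*ˡ (eqNat t 0) (comps n m) _) ⟩
  eqNat t 0 * ΣL (comps n m) (λ α → coef′ α * eqList α β)
    ≡⟨ cong (eqNat t 0 *_) (ΣL-comps-eqList n m coef′ β) ⟩
  eqNat t 0 * (eqNat (length β) n * (eqNat (sum β) m * coef′ β))  ∎
  where
  open ≡-Reasoning
  w = wordOf β ++ x^ t
  n = r + s₁ + s₂
  m = a + b₁ + b₂
  coef′ = coef a b₁ b₂ r s₁ s₂

sum-take+drop : ∀ m (γ : List ℕ) → sum (take m γ) + sum (drop m γ) ≡ sum γ
sum-take+drop m γ = trans (sym (sum-++ (take m γ) (drop m γ))) (cong sum (take++drop≡id m γ))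

length-drop-+ : ∀ m e (γ : List ℕ) → length γ ≡ m + e → length (drop m γ) ≡ e
length-drop-+ m e γ h = trans (length-drop m γ) (trans (cong (_∸ m) h) (m+n∸m≡n m e))

leNat-length : ∀ m e (γ : List ℕ) → length γ ≡ m + e → leNat m (length γ) ≡ 1
leNat-length m e γ h = ≤⇒leNat≡1 (subst (m ≤_) (sym h) (m≤m+n m e))

reaches-spec : ∀ j c γ → reaches j c γ ≡ leNat (suc j) (length γ) * eqNat (sum (take (suc j) γ)) c
reaches-spec j c [] = refl
reaches-spec zero c (b ∷ γ) = trans (cong (λ s → eqNat s c) (sym (+-identityʳ b))) (sym (+-identityʳ _))
reaches-spec (suc j) c (b ∷ γ) =
  trans (cong (leNat b c *_) (reaches-spec j (c ∸ b) γ))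
  (trans (x∙yz≈y∙xz (leNat b c) (leNat (suc j) (length γ)) _) (cong (leNat (suc j) (length γ) *_) (leNat*eqNat-∸ b _ c)))

reaches-length : ∀ j e c γ → length γ ≡ suc j + e → reaches j c γ ≡ eqNat (sum (take (suc j) γ)) c
reaches-length j e c γ h =
  trans (reaches-spec j c γ) (trans (cong (_* eqNat (sum (take (suc j) γ)) c) (leNat-length (suc j) e γ h)) (+-identityʳ _))

zeroPrefix-length : ∀ m e γ → length γ ≡ m + e → zeroPrefix m γ ≡ eqNat (sum (take m γ)) 0
zeroPrefix-length zero e γ _ = refl
zeroPrefix-length (suc m) e (b ∷ γ) h =
  trans (cong (eqNat b 0 *_) (zeroPrefix-length m e γ (suc-injective h))) (sym (eqNat-+-0 b _))

fitsIn-length : ∀ m e c γ → length γ ≡ m + e → fitsIn m c γ ≡ leNat (sum (take m γ)) c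
fitsIn-length zero e c γ _ = refl
fitsIn-length (suc m) e c (b ∷ γ) h =
  trans (cong (leNat b c *_) (fitsIn-length m e (c ∸ b) γ (suc-injective h))) (leNat*leNat-∸ b _ c)

remainder-spec : ∀ m c γ → remainder m c γ ≡ c ∸ sum (take m γ)
remainder-spec zero c γ = refl
remainder-spec (suc m) c [] = refl
remainder-spec (suc m) c (b ∷ γ) = trans (remainder-spec m (c ∸ b) γ) (∸-+-assoc c b _)

eqWord-y^-wordOf : ∀ m γ → length γ ≡ m → eqWord (y^ m) (wordOf γ) ≡ eqNat (sum γ) 0
eqWord-y^-wordOf zero [] _ = refl
eqWord-y^-wordOf (suc m) (zero ∷ γ) h = trans (+-identityʳ _) (eqWord-y^-wordOf m γ (suc-injective h))
eqWord-y^-wordOf (suc m) (suc b ∷ γ) h = refl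

eqWord-x^y^-wordOf : ∀ i k b γ → length γ ≡ k →
                     eqWord (x^ i ++ y^ (suc k)) (wordOf (b ∷ γ)) ≡ eqNat b i * eqNat (sum γ) 0
eqWord-x^y^-wordOf i k b γ h =
  trans (cong (eqWord (x^ i ++ y^ (suc k))) (wordOf-∷ b γ))
  (trans (eqWord-x^y i b (y^ k) (wordOf γ)) (cong (eqNat b i *_) (eqWord-y^-wordOf k γ h)))

Π< : ℕ → (ℕ → ℕ) → ℕ
Π< zero f = 1
Π< (suc m) f = f 0 * Π< m (f ∘ suc)

product-applyUpTo : ∀ (h : ℕ → ℕ) m (g : ℕ → ℕ) → product (map g (applyUpTo h m)) ≡ Π< m (g ∘ h)
product-applyUpTo h zero g = refl
product-applyUpTo h (suc m) g = cong (g (h 0) *_) (product-applyUpTo (h ∘ suc) m g)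

Π<-1 : ∀ m {f} → (∀ j → f j ≡ 1) → Π< m f ≡ 1
Π<-1 zero _ = refl
Π<-1 (suc m) f≗1 = cong₂ _*_ (f≗1 0) (Π<-1 m (f≗1 ∘ suc))

Π<-δ-at : ∀ p m α → Π< m (λ i → δ (at α (suc (p + i))) 0) ≡ eqNat (sum (take m (drop p α))) 0
Π<-δ-at p m [] =
  trans (Π<-1 m (λ _ → refl)) (cong (λ γ → eqNat (sum γ) 0) (sym (trans (cong (take m) (drop-[] p)) (take-[] m))))
Π<-δ-at p zero (b ∷ α) = refl
Π<-δ-at zero (suc m) (b ∷ α) = trans (cong₂ _*_ (δ≡eqNat b 0) (Π<-δ-at zero m α)) (sym (eqNat-+-0 b _))
Π<-δ-at (suc p) (suc m) (b ∷ α) = Π<-δ-at p (suc m) α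

D0-spec : ∀ α p q → D0 α (suc p) q ≡ eqNat (sum (take (q ∸ p) (drop p α))) 0
D0-spec α p q = trans (cong product (sym (map-∘ (upTo (q ∸ p)))))
                      (trans (product-applyUpTo (λ i → i) (q ∸ p) _) (Π<-δ-at p (q ∸ p) α))

-- Positions in the proposition are 1-based: α_{p+2}, …, α_{p+1+e} of α₁ ∷ β are the entries
-- p, …, p+e-1 of β.
D0-segment : ∀ α₁ β p e → D0 (α₁ ∷ β) (p + 2) (p + 1 + e) ≡ eqNat (sum (take e (drop p β))) 0
D0-segment α₁ β p e = begin
  D0 (α₁ ∷ β) (p + 2) (p + 1 + e)                          ≡⟨ cong (λ q → D0 (α₁ ∷ β) q (p + 1 + e)) (+-suc p 1) ⟩
  D0 (α₁ ∷ β) (suc (p + 1)) (p + 1 + e)                    ≡⟨ D0-spec (α₁ ∷ β) (p + 1) (p + 1 + e) ⟩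
  eqNat (sum (take (p + 1 + e ∸ (p + 1)) (drop (p + 1) (α₁ ∷ β)))) 0
    ≡⟨ cong₂ (λ l d → eqNat (sum (take l (drop d (α₁ ∷ β)))) 0) (m+n∸m≡n (p + 1) e) (+-comm p 1) ⟩
  eqNat (sum (take e (drop p β))) 0                        ∎
  where open ≡-Reasoning

D0-suffix : ∀ α₁ β p e → length (drop p β) ≡ e → D0 (α₁ ∷ β) (p + 2) (p + 1 + e) ≡ eqNat (sum (drop p β)) 0
D0-suffix α₁ β p e h = trans (D0-segment α₁ β p e) (cong (λ γ → eqNat (sum γ) 0) (take-all e (drop p β) (≤-reflexive h)))

δ-psum : ∀ α₁ β p A → δ (psum (α₁ ∷ β) (p + 1)) A ≡ eqNat (α₁ + sum (take p β)) A
δ-psum α₁ β p A = trans (δ≡eqNat _ A) (cong (λ q → eqNat (sum (take q (α₁ ∷ β))) A) (+-comm p 1))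

at-≡ : ∀ β p {c β₂} → drop p β ≡ c ∷ β₂ → at β (suc p) ≡ c
at-≡ [] zero ()
at-≡ [] (suc p) ()
at-≡ (b ∷ β) zero refl = refl
at-≡ (b ∷ β) (suc p) h = at-≡ β p h

at-∷-≡ : ∀ α₁ β p {c β₂} → drop p β ≡ c ∷ β₂ → at (α₁ ∷ β) (suc p + 1) ≡ c
at-∷-≡ α₁ β p h = trans (cong (at (α₁ ∷ β)) (cong suc (+-comm p 1))) (at-≡ β p h)

module _ where
  open import Data.Integer using (+_)

  minus-zero : ∀ p → + p ℤ.- + 0 ≡ + p
  minus-zero p = cong +_ (+-identityʳ p)

  suc-minus-suc : ∀ p q → + suc p ℤ.- + suc q ≡ + p ℤ.- + q
  suc-minus-suc p q = trans (ℤP.m-n≡m⊖n (suc p) (suc q)) (trans (ℤP.[1+m]⊖[1+n]≡m⊖n p q) (sym (ℤP.m-n≡m⊖n p q)))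

  +-minus : ∀ d e → + (d + e) ℤ.- + d ≡ + e
  +-minus zero e = minus-zero e
  +-minus (suc d) e = trans (suc-minus-suc (d + e) d) (+-minus d e)

  binom-minus : ∀ {p d e} t → p ≡ d + e → binom (+ p ℤ.- + d) (+ t) ≡ e C t
  binom-minus {d = d} {e} t refl = cong (λ z → binom z (+ t)) (+-minus d e)

  binom-minus-minus : ∀ {p d₁ d₂ e} t → p ≡ d₁ + (d₂ + e) → binom (+ p ℤ.- + d₁ ℤ.- + d₂) (+ t) ≡ e C t
  binom-minus-minus {d₁ = d₁} {d₂} {e} t refl =
    trans (cong (λ z → binom (z ℤ.- + d₂) (+ t)) (+-minus d₁ (d₂ + e))) (binom-minus {d = d₂} {e} t refl)

  binom-lower-minus : ∀ c p q → binom (+ c) (+ p ℤ.- + q) ≡ leNat q p * (c C (p ∸ q))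
  binom-lower-minus c p zero = trans (cong (binom (+ c)) (minus-zero p)) (sym (+-identityʳ _))
  binom-lower-minus c zero (suc q) = refl
  binom-lower-minus c (suc p) (suc q) = trans (cong (binom (+ c)) (suc-minus-suc p q)) (binom-lower-minus c p q)

  -- Here s = s₁ - 1; at r = s = 0 this uses the convention binom(-1, 0) = 1.
  binom-r+s-2 : ∀ s r → binom (+ r ℤ.+ + suc s ℤ.- + 2) (+ r) ≡ multichoose s r
  binom-r+s-2 zero zero = refl
  binom-r+s-2 zero (suc r) = trans (binom-minus {d = 2} {r} (suc r) (+-comm (suc r) 1)) (k>n⇒nCk≡0 (n<1+n r))
  binom-r+s-2 (suc m) r = trans (binom-minus {d = 2} r (arith r m)) (sym (multichoose-suc m r))
    where
    arith : ∀ r m → r + suc (suc m) ≡ 2 + (r + m)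
    arith = solve-∀

  binom-r+s-1 : ∀ s r → binom (+ r ℤ.+ + suc s ℤ.- + 1) (+ r) ≡ (r + s) C r
  binom-r+s-1 s r = binom-minus {d = 1} r (+-suc r s)

  binom-r+s-l-2 : ∀ r l m → binom (+ suc r ℤ.+ + suc (l + m) ℤ.- + suc l ℤ.- + 2) (+ suc r ℤ.- + 1) ≡ multichoose m r
  binom-r+s-l-2 r l m =
    trans (cong₂ binom (cong (ℤ._- + 2) (trans (cong (λ p → + p ℤ.- + suc l) (arith r l m)) (+-minus (suc l) (r + suc m))))
                       (+-minus 1 r))
          (binom-r+s-2 m r)
    where
    arith : ∀ r l m → suc r + suc (l + m) ≡ suc l + (r + suc m)
    arith = solve-∀

  binom-r+s-l-1 : ∀ k l e → binom (+ suc k ℤ.+ + suc (l + e) ℤ.- + suc l ℤ.- + 1) (+ suc k ℤ.- + 1) ≡ (k + e) C k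
  binom-r+s-l-1 k l e = trans (cong (binom (+ suc k ℤ.+ + suc (l + e) ℤ.- + suc l ℤ.- + 1)) (+-minus 1 k))
                              (binom-minus-minus {d₁ = suc l} {1} k (arith k l e))
    where
    arith : ∀ k l e → suc k + suc (l + e) ≡ suc l + (1 + (k + e))
    arith = solve-∀

  binom-r+s-s-1≡1 : ∀ k s → binom (+ suc k ℤ.+ + suc s ℤ.- + suc s ℤ.- + 1) (+ suc k ℤ.- + 1) ≡ 1
  binom-r+s-s-1≡1 k s = begin
    binom (+ suc k ℤ.+ + suc s ℤ.- + suc s ℤ.- + 1) (+ suc k ℤ.- + 1)
      ≡⟨ cong (λ s′ → binom (+ suc k ℤ.+ + suc s′ ℤ.- + suc s ℤ.- + 1) (+ suc k ℤ.- + 1)) (sym (+-identityʳ s)) ⟩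
    binom (+ suc k ℤ.+ + suc (s + 0) ℤ.- + suc s ℤ.- + 1) (+ suc k ℤ.- + 1)
      ≡⟨ binom-r+s-l-1 k s 0 ⟩
    (k + 0) C k
      ≡⟨ trans (cong (_C k) (+-identityʳ k)) (nCn≡1 k) ⟩
    1  ∎
    where open ≡-Reasoning

-- The four sums

cons-of-length : ∀ (γ : List ℕ) {n} → length γ ≡ suc n → Σ[ h ∈ ℕ ] Σ[ γ′ ∈ List ℕ ] γ ≡ h ∷ γ′
cons-of-length (h ∷ γ′) _ = h , γ′ , refl

*-Σ≤ : ∀ c k f g → (∀ j → j ≤ k → c * f j ≡ g j) → c * Σ≤ k f ≡ Σ≤ k g
*-Σ≤ c k f g cf≗g = trans (Σ<-*ˡ c (suc k) f) (Σ≤-congB k cf≗g)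

*-Σ< : ∀ c m f g → (∀ j → j < m → c * f j ≡ g j) → c * Σ< m f ≡ Σ< m g
*-Σ< c m f g cf≗g = trans (Σ<-*ˡ c m f) (Σ<-congB m cf≗g)

split₂ : ∀ {k j₁ j₂} → j₁ ≤ k → j₂ ≤ k ∸ j₁ → k ≡ j₁ + (j₂ + (k ∸ j₁ ∸ j₂))
split₂ {j₁ = j₁} h₁ h₂ = trans (sym (m+[n∸m]≡n h₁)) (cong (j₁ +_) (sym (m+[n∸m]≡n h₂)))

split₃ : ∀ {k j₁ j₂ j₃} → j₁ ≤ k → j₂ ≤ k ∸ j₁ → j₃ ≤ k ∸ j₁ ∸ j₂ →
         k ≡ j₁ + (j₂ + (j₃ + (k ∸ j₁ ∸ j₂ ∸ j₃)))
split₃ {j₁ = j₁} {j₂} h₁ h₂ h₃ = trans (split₂ h₁ h₂) (cong (λ t → j₁ + (j₂ + t)) (sym (m+[n∸m]≡n h₃)))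

*≡1⇒ : ∀ m n → m * n ≡ 1 → m ≡ 1 × n ≡ 1
*≡1⇒ m n mn≡1 = m*n≡1⇒m≡1 m n mn≡1 , m*n≡1⇒n≡1 m n mn≡1

eqNat-implied : ∀ s₁ s₂ s₃ s₄ A B → s₁ + (s₂ + (s₃ + s₄)) ≡ A + B →
  eqNat s₁ A * eqNat s₂ 0 * eqNat s₃ B * eqNat s₄ 0 ≡ eqNat s₁ A * eqNat s₂ 0 * eqNat s₄ 0
eqNat-implied s₁ s₂ s₃ s₄ A B total =
  trans (swap₃₄ (eqNat s₁ A) (eqNat s₂ 0) (eqNat s₃ B) (eqNat s₄ 0))
        (bit*-implied _ (eqNat s₃ B) (*-bit (*-bit (eqNat-bit s₁ A) (eqNat-bit s₂ 0)) (eqNat-bit s₄ 0)) implied)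
  where
  swap₃₄ : ∀ p q r s → p * q * r * s ≡ p * q * s * r
  swap₃₄ = solve-∀
  implied : eqNat s₁ A * eqNat s₂ 0 * eqNat s₄ 0 ≡ 1 → eqNat s₃ B ≡ 1
  implied e with *≡1⇒ (eqNat s₁ A * eqNat s₂ 0) (eqNat s₄ 0) e
  ... | e₁₂ , e₄ with *≡1⇒ (eqNat s₁ A) (eqNat s₂ 0) e₁₂
  ... | e₁ , e₂ with eqNat≡1⇒≡ s₁ A e₁ | eqNat≡1⇒≡ s₂ 0 e₂ | eqNat≡1⇒≡ s₄ 0 e₄
  ... | refl | refl | refl = ≡⇒eqNat≡1 (+-cancelˡ-≡ s₁ s₃ B (trans (cong (s₁ +_) (sym (+-identityʳ s₃))) total))

leNat-eqNat-implied : ∀ p z w A B → p + z + w ≡ A + B →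
  leNat p A * eqNat z (A ∸ p + B) * eqNat w 0 ≡ leNat p A * eqNat w 0
leNat-eqNat-implied p z w A B total =
  trans (swap₂₃ (leNat p A) (eqNat z (A ∸ p + B)) (eqNat w 0))
        (bit*-implied _ (eqNat z (A ∸ p + B)) (*-bit (leNat-bit p A) (eqNat-bit w 0)) implied)
  where
  swap₂₃ : ∀ p q r → p * q * r ≡ p * r * q
  swap₂₃ = solve-∀
  implied : leNat p A * eqNat w 0 ≡ 1 → eqNat z (A ∸ p + B) ≡ 1
  implied e with *≡1⇒ (leNat p A) (eqNat w 0) e
  ... | e₁ , e₂ with eqNat≡1⇒≡ w 0 e₂
  ... | refl = ≡⇒eqNat≡1 (+-cancelˡ-≡ p z (A ∸ p + B) (begin
    p + z                 ≡⟨ sym (+-identityʳ (p + z)) ⟩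
    p + z + 0             ≡⟨ total ⟩
    A + B                 ≡⟨ cong (_+ B) (sym (m+[n∸m]≡n (leNat≡1⇒≤ p A e₁))) ⟩
    p + (A ∸ p) + B       ≡⟨ +-assoc p (A ∸ p) B ⟩
    p + (A ∸ p + B)       ∎))
    where open ≡-Reasoning

leNat-eqNat-forced : ∀ p z w A B → p + z + w ≡ A + B → B ≤ z →
  leNat p A * eqNat z (A ∸ p + B) * eqNat w 0 ≡ eqNat w 0
leNat-eqNat-forced p z w A B total B≤z =
  trans (leNat-eqNat-implied p z w A B total) (trans (*-comm (leNat p A) _) (bit*-implied _ (leNat p A) (eqNat-bit w 0) p≤A))
  where
  p≤A : eqNat w 0 ≡ 1 → leNat p A ≡ 1
  p≤A e with eqNat≡1⇒≡ w 0 e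
  ... | refl = ≤⇒leNat≡1 (+-cancelʳ-≤ B p A (begin
    p + B                 ≤⟨ +-monoʳ-≤ p B≤z ⟩
    p + z                 ≡⟨ sym (+-identityʳ (p + z)) ⟩
    p + z + 0             ≡⟨ total ⟩
    A + B                 ∎))
    where open ≤-Reasoning

module Blocks (α₁ A B : ℕ) (β : List ℕ) (p₁ p₂ p₃ p₄ : ℕ)
              (length-β : length β ≡ suc p₁ + (p₂ + (suc p₃ + p₄))) (total : α₁ + sum β ≡ A + B) where

  γ₁ = drop (suc p₁) β
  γ₂ = drop p₂ γ₁
  γ₃ = drop (suc p₃) γ₂
  S₁ = sum (take (suc p₁) β)
  S₂ = sum (take p₂ γ₁)
  S₃ = sum (take (suc p₃) γ₂)
  S₄ = sum γ₃

  length-γ₁ : length γ₁ ≡ p₂ + (suc p₃ + p₄)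
  length-γ₁ = length-drop-+ (suc p₁) _ β length-β

  length-γ₂ : length γ₂ ≡ suc p₃ + p₄
  length-γ₂ = length-drop-+ p₂ _ γ₁ length-γ₁

  length-γ₃ : length γ₃ ≡ p₄
  length-γ₃ = length-drop-+ (suc p₃) _ γ₂ length-γ₂

  γ₃≡drop : γ₃ ≡ drop (suc p₁ + p₂ + suc p₃) β
  γ₃≡drop = trans (cong (drop (suc p₃)) (drop-drop (suc p₁) p₂ β)) (drop-drop (suc p₁ + p₂) (suc p₃) β)

  total-blocks : (α₁ + S₁) + (S₂ + (S₃ + S₄)) ≡ A + B
  total-blocks = trans (+-assoc α₁ S₁ _) (trans (cong (α₁ +_) (begin
    S₁ + (S₂ + (S₃ + S₄))      ≡⟨ cong (λ s → S₁ + (S₂ + s)) (sum-take+drop (suc p₃) γ₂) ⟩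
    S₁ + (S₂ + sum γ₂)         ≡⟨ cong (S₁ +_) (sum-take+drop p₂ γ₁) ⟩
    S₁ + sum γ₁                ≡⟨ sum-take+drop (suc p₁) β ⟩
    sum β                      ∎)) total)
    where open ≡-Reasoning

  blocks : leNat α₁ A * reaches p₁ (A ∸ α₁) β * zeroPrefix p₂ γ₁ * reaches p₃ B γ₂ * eqWord (y^ p₄) (wordOf γ₃)
           ≡ eqNat (α₁ + S₁) A * eqNat S₂ 0 * eqNat S₄ 0
  blocks = begin
    leNat α₁ A * reaches p₁ (A ∸ α₁) β * zeroPrefix p₂ γ₁ * reaches p₃ B γ₂ * eqWord (y^ p₄) (wordOf γ₃)
      ≡⟨ cong₂ _*_ (cong₂ _*_ (cong₂ _*_
           (trans (cong (leNat α₁ A *_) (reaches-length p₁ _ (A ∸ α₁) β length-β)) (leNat*eqNat-∸ α₁ S₁ A))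
           (zeroPrefix-length p₂ _ γ₁ length-γ₁))
           (reaches-length p₃ p₄ B γ₂ length-γ₂))
           (eqWord-y^-wordOf p₄ γ₃ length-γ₃) ⟩
    eqNat (α₁ + S₁) A * eqNat S₂ 0 * eqNat S₃ B * eqNat S₄ 0
      ≡⟨ eqNat-implied (α₁ + S₁) S₂ S₃ S₄ A B total-blocks ⟩
    eqNat (α₁ + S₁) A * eqNat S₂ 0 * eqNat S₄ 0  ∎
    where open ≡-Reasoning

  paper-blocks : ∀ {q P N} → q ≡ suc p₁ + 1 + p₂ → P ≡ suc p₁ + p₂ + suc p₃ → N ≡ P + 1 + p₄ →
    δ (psum (α₁ ∷ β) (suc p₁ + 1)) A * D0 (α₁ ∷ β) (suc p₁ + 2) q * D0 (α₁ ∷ β) (P + 2) N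
      ≡ eqNat (α₁ + S₁) A * eqNat S₂ 0 * eqNat S₄ 0
  paper-blocks refl refl refl = cong₂ _*_ (cong₂ _*_ (δ-psum α₁ β (suc p₁) A) (D0-segment α₁ β (suc p₁) p₂))
    (trans (D0-suffix α₁ β (suc p₁ + p₂ + suc p₃) p₄ (trans (cong length (sym γ₃≡drop)) length-γ₃))
           (cong (λ γ → eqNat (sum γ) 0) (sym γ₃≡drop)))

-- The summands of the four sums in coef; coef unfolds definitionally to these sums.
module _ where
  open import Data.Integer using (+_)

  summand₁ : ℕ → ℕ → ℕ → ℕ → ℕ → ℕ → List ℕ → ℕ → ℕ → ℕ → ℕ
  summand₁ a b₁ b₂ r s₁ s₂ α r₁ r₂ r₃ =
    binom (+ at α 1) (+ a)
    * binom (+ r₂ ℤ.+ + s₁ ℤ.- + 2) (+ r₂)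
    * binom (+ (r ∸ r₁ ∸ r₂ ∸ r₃) ℤ.+ + s₂ ℤ.- + 1) (+ (r ∸ r₁ ∸ r₂ ∸ r₃))
    * δ (psum α (r₁ + 1)) (a + b₁)
    * D0 α (r₁ + 2) (r₁ + r₂ + s₁)
    * D0 α (r₁ + r₂ + r₃ + s₁ + 2) (r + s₁ + s₂)

  summand₂ : ℕ → ℕ → ℕ → ℕ → ℕ → ℕ → List ℕ → ℕ → ℕ → ℕ → ℕ
  summand₂ a b₁ b₂ r s₁ s₂ α r₁ r₂ l =
    binom (+ at α 1) (+ b₁)
    * binom (+ r₁ ℤ.+ + s₁ ℤ.- + l ℤ.- + 2) (+ r₁ ℤ.- + 1)
    * binom (+ (r ∸ r₁ ∸ r₂) ℤ.+ + s₂ ℤ.- + 1) (+ (r ∸ r₁ ∸ r₂))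
    * δ (psum α (l + 1)) (a + b₁)
    * D0 α (l + 2) (r₁ + s₁)
    * D0 α (r₁ + r₂ + s₁ + 2) (r + s₁ + s₂)

  summand₃ : ℕ → ℕ → ℕ → ℕ → ℕ → ℕ → List ℕ → ℕ → ℕ
  summand₃ a b₁ b₂ r s₁ s₂ α r₁ =
    binom (+ at α 1) (+ b₁)
    * binom (+ at α (s₁ + 1)) (+ (a + b₁) ℤ.- + psum α s₁)
    * binom (+ (r ∸ r₁) ℤ.+ + s₂ ℤ.- + 1) (+ (r ∸ r₁))
    * D0 α (r₁ + s₁ + 2) (r + s₁ + s₂)

  summand₄ : ℕ → ℕ → ℕ → ℕ → ℕ → ℕ → List ℕ → ℕ → ℕ
  summand₄ a b₁ b₂ r s₁ s₂ α l =
    binom (+ at α 1) (+ b₁)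
    * binom (+ at α (s₁ + 1)) (+ b₂)
    * binom (+ r ℤ.+ + s₂ ℤ.- + l ℤ.- + 1) (+ r ℤ.- + 1)
    * D0 α (s₁ + l + 2) (r + s₁ + s₂)

-- k, s₁′, s₂′ stand for r - 1, s₁ - 1, s₂ - 1, and the word is wordOf (α₁ ∷ β).
module Expansion (a b₁ b₂ k s₁′ s₂′ α₁ : ℕ) (β : List ℕ)
                 (length-β : length β ≡ k + suc s₁′ + suc s₂′) (total : α₁ + sum β ≡ a + b₁ + b₂) where

  α = α₁ ∷ β
  A = a + b₁
  i₁ = A ∸ α₁
  zs = replicate s₂′ 0
  R = replicate s₁′ 0 ++ b₂ ∷ zs

  σ₁ = summand₁ a b₁ b₂ (suc k) (suc s₁′) (suc s₂′) α
  σ₂ = summand₂ a b₁ b₂ (suc k) (suc s₁′) (suc s₂′) α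
  σ₃ = summand₃ a b₁ b₂ (suc k) (suc s₁′) (suc s₂′) α
  σ₄ = summand₄ a b₁ b₂ (suc k) (suc s₁′) (suc s₂′) α
  c₁ = (α₁ C a) * leNat α₁ A
  c₂ = (α₁ C b₁) * leNat α₁ A

  mult-y^-zs : ∀ K w → mult (y^ K) (wordOf zs) w ≡ ((K + s₂′) C K) * eqWord (y^ (K + s₂′)) w
  mult-y^-zs K w = trans (cong (λ v → mult (y^ K) v w) (wordOf-zeros s₂′)) (mult-y^-y^ K s₂′ w)

  module Term₁ (j₁ j₂ j₃ : ℕ) (k≡ : k ≡ j₁ + (j₂ + (j₃ + (k ∸ j₁ ∸ j₂ ∸ j₃)))) where
    K = k ∸ j₁ ∸ j₂ ∸ j₃

    length′ : length β ≡ suc j₁ + ((s₁′ + j₂) + (suc j₃ + (K + s₂′)))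
    length′ = trans length-β (trans (cong (λ k → k + suc s₁′ + suc s₂′) k≡) (arith j₁ j₂ j₃ K s₁′ s₂′))
      where
      arith : ∀ j₁ j₂ j₃ K s₁′ s₂′ → j₁ + (j₂ + (j₃ + K)) + suc s₁′ + suc s₂′ ≡ suc j₁ + ((s₁′ + j₂) + (suc j₃ + (K + s₂′)))
      arith = solve-∀

    open Blocks α₁ A b₂ β j₁ (s₁′ + j₂) j₃ (K + s₂′) length′ total

    positions : δ (psum α (suc j₁ + 1)) A * D0 α (suc j₁ + 2) (suc j₁ + j₂ + suc s₁′)
                * D0 α (suc j₁ + j₂ + j₃ + suc s₁′ + 2) (suc k + suc s₁′ + suc s₂′)
                ≡ eqNat (α₁ + S₁) A * eqNat S₂ 0 * eqNat S₄ 0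
    positions = paper-blocks (arith₁ j₁ j₂ s₁′) (arith₂ j₁ j₂ j₃ s₁′)
                  (trans (cong (λ k → suc k + suc s₁′ + suc s₂′) k≡) (arith₃ j₁ j₂ j₃ K s₁′ s₂′))
      where
      arith₁ : ∀ j₁ j₂ s₁′ → suc j₁ + j₂ + suc s₁′ ≡ suc j₁ + 1 + (s₁′ + j₂)
      arith₁ = solve-∀
      arith₂ : ∀ j₁ j₂ j₃ s₁′ → suc j₁ + j₂ + j₃ + suc s₁′ ≡ suc j₁ + (s₁′ + j₂) + suc j₃
      arith₂ = solve-∀
      arith₃ : ∀ j₁ j₂ j₃ K s₁′ s₂′ → suc (j₁ + (j₂ + (j₃ + K))) + suc s₁′ + suc s₂′ ≡ suc j₁ + j₂ + j₃ + suc s₁′ + 1 + (K + s₂′)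
      arith₃ = solve-∀

    summand : (α₁ C a) * leNat α₁ A * reaches j₁ i₁ β * (multichoose s₁′ j₂ * zeroPrefix (s₁′ + j₂) γ₁)
              * (reaches j₃ b₂ γ₂ * mult (y^ K) (wordOf zs) (wordOf γ₃))
              ≡ σ₁ (suc j₁) j₂ j₃
    summand = begin
      (α₁ C a) * leNat α₁ A * reaches j₁ i₁ β * (multichoose s₁′ j₂ * zeroPrefix (s₁′ + j₂) γ₁)
        * (reaches j₃ b₂ γ₂ * mult (y^ K) (wordOf zs) (wordOf γ₃))
        ≡⟨ cong (λ t → (α₁ C a) * leNat α₁ A * reaches j₁ i₁ β * (multichoose s₁′ j₂ * zeroPrefix (s₁′ + j₂) γ₁) * (reaches j₃ b₂ γ₂ * t))
                (mult-y^-zs K (wordOf γ₃)) ⟩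
      (α₁ C a) * leNat α₁ A * reaches j₁ i₁ β * (multichoose s₁′ j₂ * zeroPrefix (s₁′ + j₂) γ₁)
        * (reaches j₃ b₂ γ₂ * (((K + s₂′) C K) * eqWord (y^ (K + s₂′)) (wordOf γ₃)))
        ≡⟨ regroup (α₁ C a) (leNat α₁ A) (reaches j₁ i₁ β) (multichoose s₁′ j₂) (zeroPrefix (s₁′ + j₂) γ₁)
                   (reaches j₃ b₂ γ₂) ((K + s₂′) C K) (eqWord (y^ (K + s₂′)) (wordOf γ₃)) ⟩
      (α₁ C a) * multichoose s₁′ j₂ * ((K + s₂′) C K)
        * indicators
        ≡⟨ cong₂ (λ p q → (α₁ C a) * p * q * indicators) (sym (binom-r+s-2 s₁′ j₂)) (sym (binom-r+s-1 s₂′ K)) ⟩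
      (α₁ C a) * binom₂ * binom₃ * indicators
        ≡⟨ cong ((α₁ C a) * binom₂ * binom₃ *_) (trans blocks (sym positions)) ⟩
      (α₁ C a) * binom₂ * binom₃ * (δ′ * D0₂ * D0₄)
        ≡⟨ assoc₃ ((α₁ C a) * binom₂ * binom₃) δ′ D0₂ D0₄ ⟩
      (α₁ C a) * binom₂ * binom₃ * δ′ * D0₂ * D0₄  ∎
      where
      open ≡-Reasoning
      open import Data.Integer using (+_)
      indicators = leNat α₁ A * reaches j₁ i₁ β * zeroPrefix (s₁′ + j₂) γ₁ * reaches j₃ b₂ γ₂ * eqWord (y^ (K + s₂′)) (wordOf γ₃)
      binom₂ = binom (+ j₂ ℤ.+ + suc s₁′ ℤ.- + 2) (+ j₂)
      binom₃ = binom (+ K ℤ.+ + suc s₂′ ℤ.- + 1) (+ K)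
      δ′ = δ (psum α (suc j₁ + 1)) A
      D0₂ = D0 α (suc j₁ + 2) (suc j₁ + j₂ + suc s₁′)
      D0₄ = D0 α (suc j₁ + j₂ + j₃ + suc s₁′ + 2) (suc k + suc s₁′ + suc s₂′)
      regroup : ∀ c l t m z t′ d e → c * l * t * (m * z) * (t′ * (d * e)) ≡ c * m * d * (l * t * z * t′ * e)
      regroup = solve-∀
      assoc₃ : ∀ p q r s → p * (q * r * s) ≡ p * q * r * s
      assoc₃ = solve-∀

  term₁-inner : ∀ j₁ j₂ → j₁ ≤ k → j₂ ≤ k ∸ j₁ →
    let γ₁ = drop (suc j₁) β ; γ₂ = drop (s₁′ + j₂) γ₁ in
    c₁ * reaches j₁ i₁ β * (multichoose s₁′ j₂ * zeroPrefix (s₁′ + j₂) γ₁ * mult (y^ (k ∸ j₁ ∸ j₂)) (wordOf (b₂ ∷ zs)) (wordOf γ₂))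
    ≡ sumR 0 (k ∸ j₁ ∸ j₂) (σ₁ (suc j₁) j₂)
  term₁-inner j₁ j₂ j₁≤k j₂≤ = begin
    c₁ * T * (MZ * mult (y^ (k ∸ j₁ ∸ j₂)) (wordOf (b₂ ∷ zs)) (wordOf γ₂))
      ≡⟨ cong (λ t → c₁ * T * (MZ * t)) (mult-y^-wordOf (k ∸ j₁ ∸ j₂) b₂ zs γ₂) ⟩
    c₁ * T * (MZ * Σ≤ (k ∸ j₁ ∸ j₂) f)
      ≡⟨ sym (*-assoc (c₁ * T) MZ _) ⟩
    c₁ * T * MZ * Σ≤ (k ∸ j₁ ∸ j₂) f
      ≡⟨ *-Σ≤ (c₁ * T * MZ) (k ∸ j₁ ∸ j₂) f _ (λ j₃ j₃≤ → Term₁.summand j₁ j₂ j₃ (split₃ j₁≤k j₂≤ j₃≤)) ⟩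
    Σ≤ (k ∸ j₁ ∸ j₂) (σ₁ (suc j₁) j₂)
      ≡⟨ sym (sumR≡Σ< 0 (k ∸ j₁ ∸ j₂) _) ⟩
    sumR 0 (k ∸ j₁ ∸ j₂) (σ₁ (suc j₁) j₂)  ∎
    where
    open ≡-Reasoning
    γ₁ = drop (suc j₁) β
    γ₂ = drop (s₁′ + j₂) γ₁
    T = reaches j₁ i₁ β
    MZ = multichoose s₁′ j₂ * zeroPrefix (s₁′ + j₂) γ₁
    f = λ j₃ → reaches j₃ b₂ γ₂ * mult (y^ (k ∸ j₁ ∸ j₂ ∸ j₃)) (wordOf zs) (wordOf (drop (suc j₃) γ₂))

  term₁-middle : ∀ j₁ → j₁ ≤ k →
    c₁ * (reaches j₁ i₁ β * mult (y^ (k ∸ j₁)) (wordOf R) (wordOf (drop (suc j₁) β)))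
    ≡ sumR 0 (k ∸ j₁) (λ j₂ → sumR 0 (k ∸ j₁ ∸ j₂) (σ₁ (suc j₁) j₂))
  term₁-middle j₁ j₁≤k = begin
    c₁ * (T * mult (y^ (k ∸ j₁)) (wordOf R) (wordOf γ₁))
      ≡⟨ cong (λ t → c₁ * (T * t)) (mult-y^-zeros s₁′ (k ∸ j₁) (b₂ ∷ zs) γ₁) ⟩
    c₁ * (T * Σ≤ (k ∸ j₁) f)
      ≡⟨ sym (*-assoc c₁ T _) ⟩
    c₁ * T * Σ≤ (k ∸ j₁) f
      ≡⟨ *-Σ≤ (c₁ * T) (k ∸ j₁) f _ (λ j₂ j₂≤ → term₁-inner j₁ j₂ j₁≤k j₂≤) ⟩
    Σ≤ (k ∸ j₁) (λ j₂ → sumR 0 (k ∸ j₁ ∸ j₂) (σ₁ (suc j₁) j₂))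
      ≡⟨ sym (sumR≡Σ< 0 (k ∸ j₁) _) ⟩
    sumR 0 (k ∸ j₁) (λ j₂ → sumR 0 (k ∸ j₁ ∸ j₂) (σ₁ (suc j₁) j₂))  ∎
    where
    open ≡-Reasoning
    γ₁ = drop (suc j₁) β
    T = reaches j₁ i₁ β
    f = λ j₂ → multichoose s₁′ j₂ * zeroPrefix (s₁′ + j₂) γ₁ * mult (y^ (k ∸ j₁ ∸ j₂)) (wordOf (b₂ ∷ zs)) (wordOf (drop (s₁′ + j₂) γ₁))

  term₁-eq : c₁ * mult (y^ k) (wordOf (i₁ ∷ R)) (wordOf β)
             ≡ sumR 1 (suc k) (λ r₁ → sumR 0 (suc k ∸ r₁) (λ r₂ → sumR 0 (suc k ∸ r₁ ∸ r₂) (σ₁ r₁ r₂)))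
  term₁-eq = begin
    c₁ * mult (y^ k) (wordOf (i₁ ∷ R)) (wordOf β)
      ≡⟨ cong (c₁ *_) (mult-y^-wordOf k i₁ R β) ⟩
    c₁ * Σ≤ k (λ j₁ → reaches j₁ i₁ β * mult (y^ (k ∸ j₁)) (wordOf R) (wordOf (drop (suc j₁) β)))
      ≡⟨ *-Σ≤ c₁ k _ _ term₁-middle ⟩
    Σ≤ k (λ j₁ → sumR 0 (k ∸ j₁) (λ j₂ → sumR 0 (k ∸ j₁ ∸ j₂) (σ₁ (suc j₁) j₂)))
      ≡⟨ sym (sumR≡Σ< 1 (suc k) _) ⟩
    sumR 1 (suc k) (λ r₁ → sumR 0 (suc k ∸ r₁) (λ r₂ → sumR 0 (suc k ∸ r₁ ∸ r₂) (σ₁ r₁ r₂)))  ∎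
    where open ≡-Reasoning

  module Term₂ (j j₂ j₃ : ℕ) (j<s₁′ : j < s₁′) (k≡ : k ≡ j₂ + (j₃ + (k ∸ j₂ ∸ j₃))) where
    K = k ∸ j₂ ∸ j₃
    m = s₁′ ∸ j

    s₁′≡ : s₁′ ≡ j + m
    s₁′≡ = sym (m+[n∸m]≡n (<⇒≤ j<s₁′))

    length′ : length β ≡ suc j + ((m + j₂) + (suc j₃ + (K + s₂′)))
    length′ = trans length-β (trans (cong₂ (λ k s → k + suc s + suc s₂′) k≡ s₁′≡) (arith j m j₂ j₃ K s₂′))
      where
      arith : ∀ j m j₂ j₃ K s₂′ → j₂ + (j₃ + K) + suc (j + m) + suc s₂′ ≡ suc j + ((m + j₂) + (suc j₃ + (K + s₂′)))
      arith = solve-∀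

    open Blocks α₁ A b₂ β j (m + j₂) j₃ (K + s₂′) length′ total

    positions : δ (psum α (suc j + 1)) A * D0 α (suc j + 2) (suc j₂ + suc s₁′)
                * D0 α (suc j₂ + j₃ + suc s₁′ + 2) (suc k + suc s₁′ + suc s₂′)
                ≡ eqNat (α₁ + S₁) A * eqNat S₂ 0 * eqNat S₄ 0
    positions = paper-blocks
      (trans (cong (λ s → suc j₂ + suc s) s₁′≡) (arith₁ j m j₂))
      (trans (cong (λ s → suc j₂ + j₃ + suc s) s₁′≡) (arith₂ j m j₂ j₃))
      (trans (cong₂ (λ k s → suc k + suc s + suc s₂′) k≡ s₁′≡)
             (trans (arith₃ j m j₂ j₃ K s₂′) (cong (λ s → suc j₂ + j₃ + suc s + 1 + (K + s₂′)) (sym s₁′≡))))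
      where
      arith₁ : ∀ j m j₂ → suc j₂ + suc (j + m) ≡ suc j + 1 + (m + j₂)
      arith₁ = solve-∀
      arith₂ : ∀ j m j₂ j₃ → suc j₂ + j₃ + suc (j + m) ≡ suc j + (m + j₂) + suc j₃
      arith₂ = solve-∀
      arith₃ : ∀ j m j₂ j₃ K s₂′ → suc (j₂ + (j₃ + K)) + suc (j + m) + suc s₂′ ≡ suc j₂ + j₃ + suc (j + m) + 1 + (K + s₂′)
      arith₃ = solve-∀

    summand : (α₁ C b₁) * leNat α₁ A * reaches j i₁ β * (multichoose m j₂ * zeroPrefix (m + j₂) γ₁)
              * (reaches j₃ b₂ γ₂ * mult (y^ K) (wordOf zs) (wordOf γ₃))
              ≡ σ₂ (suc j₂) j₃ (suc j)
    summand = begin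
      (α₁ C b₁) * leNat α₁ A * reaches j i₁ β * (multichoose m j₂ * zeroPrefix (m + j₂) γ₁)
        * (reaches j₃ b₂ γ₂ * mult (y^ K) (wordOf zs) (wordOf γ₃))
        ≡⟨ cong (λ t → (α₁ C b₁) * leNat α₁ A * reaches j i₁ β * (multichoose m j₂ * zeroPrefix (m + j₂) γ₁) * (reaches j₃ b₂ γ₂ * t))
                (mult-y^-zs K (wordOf γ₃)) ⟩
      (α₁ C b₁) * leNat α₁ A * reaches j i₁ β * (multichoose m j₂ * zeroPrefix (m + j₂) γ₁)
        * (reaches j₃ b₂ γ₂ * (((K + s₂′) C K) * eqWord (y^ (K + s₂′)) (wordOf γ₃)))
        ≡⟨ regroup (α₁ C b₁) (leNat α₁ A) (reaches j i₁ β) (multichoose m j₂) (zeroPrefix (m + j₂) γ₁)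
                   (reaches j₃ b₂ γ₂) ((K + s₂′) C K) (eqWord (y^ (K + s₂′)) (wordOf γ₃)) ⟩
      (α₁ C b₁) * multichoose m j₂ * ((K + s₂′) C K) * indicators
        ≡⟨ cong₂ (λ p q → (α₁ C b₁) * p * q * indicators)
                 (sym (trans (cong (λ s → binom (+ suc j₂ ℤ.+ + suc s ℤ.- + suc j ℤ.- + 2) (+ suc j₂ ℤ.- + 1)) s₁′≡)
                             (binom-r+s-l-2 j₂ j m)))
                 (sym (binom-r+s-1 s₂′ K)) ⟩
      (α₁ C b₁) * binom₂ * binom₃ * indicators
        ≡⟨ cong ((α₁ C b₁) * binom₂ * binom₃ *_) (trans blocks (sym positions)) ⟩
      (α₁ C b₁) * binom₂ * binom₃ * (δ′ * D0₂ * D0₄)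
        ≡⟨ assoc₃ ((α₁ C b₁) * binom₂ * binom₃) δ′ D0₂ D0₄ ⟩
      (α₁ C b₁) * binom₂ * binom₃ * δ′ * D0₂ * D0₄  ∎
      where
      open ≡-Reasoning
      open import Data.Integer using (+_)
      indicators = leNat α₁ A * reaches j i₁ β * zeroPrefix (m + j₂) γ₁ * reaches j₃ b₂ γ₂ * eqWord (y^ (K + s₂′)) (wordOf γ₃)
      binom₂ = binom (+ suc j₂ ℤ.+ + suc s₁′ ℤ.- + suc j ℤ.- + 2) (+ suc j₂ ℤ.- + 1)
      binom₃ = binom (+ K ℤ.+ + suc s₂′ ℤ.- + 1) (+ K)
      δ′ = δ (psum α (suc j + 1)) A
      D0₂ = D0 α (suc j + 2) (suc j₂ + suc s₁′)
      D0₄ = D0 α (suc j₂ + j₃ + suc s₁′ + 2) (suc k + suc s₁′ + suc s₂′)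
      regroup : ∀ c l t m z t′ d e → c * l * t * (m * z) * (t′ * (d * e)) ≡ c * m * d * (l * t * z * t′ * e)
      regroup = solve-∀
      assoc₃ : ∀ p q r s → p * (q * r * s) ≡ p * q * r * s
      assoc₃ = solve-∀

  term₂-inner : ∀ j j₂ → j < s₁′ → j₂ ≤ k →
    let γ₁ = drop (suc j) β ; γ₂ = drop (s₁′ ∸ j + j₂) γ₁ in
    c₂ * reaches j i₁ β * (multichoose (s₁′ ∸ j) j₂ * zeroPrefix (s₁′ ∸ j + j₂) γ₁ * mult (y^ (k ∸ j₂)) (wordOf (b₂ ∷ zs)) (wordOf γ₂))
    ≡ Σ≤ (k ∸ j₂) (λ j₃ → σ₂ (suc j₂) j₃ (suc j))
  term₂-inner j j₂ j<s₁′ j₂≤k = begin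
    c₂ * T * (MZ * mult (y^ (k ∸ j₂)) (wordOf (b₂ ∷ zs)) (wordOf γ₂))
      ≡⟨ cong (λ t → c₂ * T * (MZ * t)) (mult-y^-wordOf (k ∸ j₂) b₂ zs γ₂) ⟩
    c₂ * T * (MZ * Σ≤ (k ∸ j₂) f)
      ≡⟨ sym (*-assoc (c₂ * T) MZ _) ⟩
    c₂ * T * MZ * Σ≤ (k ∸ j₂) f
      ≡⟨ *-Σ≤ (c₂ * T * MZ) (k ∸ j₂) f _ (λ j₃ j₃≤ → Term₂.summand j j₂ j₃ j<s₁′ (split₂ j₂≤k j₃≤)) ⟩
    Σ≤ (k ∸ j₂) (λ j₃ → σ₂ (suc j₂) j₃ (suc j))  ∎
    where
    open ≡-Reasoning
    γ₁ = drop (suc j) β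
    γ₂ = drop (s₁′ ∸ j + j₂) γ₁
    T = reaches j i₁ β
    MZ = multichoose (s₁′ ∸ j) j₂ * zeroPrefix (s₁′ ∸ j + j₂) γ₁
    f = λ j₃ → reaches j₃ b₂ γ₂ * mult (y^ (k ∸ j₂ ∸ j₃)) (wordOf zs) (wordOf (drop (suc j₃) γ₂))

  term₂-middle : ∀ j → j < s₁′ →
    c₂ * (reaches j i₁ β * mult (y^ k) (wordOf (replicate (s₁′ ∸ j) 0 ++ b₂ ∷ zs)) (wordOf (drop (suc j) β)))
    ≡ Σ≤ k (λ j₂ → Σ≤ (k ∸ j₂) (λ j₃ → σ₂ (suc j₂) j₃ (suc j)))
  term₂-middle j j<s₁′ = begin
    c₂ * (T * mult (y^ k) (wordOf (replicate (s₁′ ∸ j) 0 ++ b₂ ∷ zs)) (wordOf γ₁))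
      ≡⟨ cong (λ t → c₂ * (T * t)) (mult-y^-zeros (s₁′ ∸ j) k (b₂ ∷ zs) γ₁) ⟩
    c₂ * (T * Σ≤ k f)
      ≡⟨ sym (*-assoc c₂ T _) ⟩
    c₂ * T * Σ≤ k f
      ≡⟨ *-Σ≤ (c₂ * T) k f _ (λ j₂ j₂≤k → term₂-inner j j₂ j<s₁′ j₂≤k) ⟩
    Σ≤ k (λ j₂ → Σ≤ (k ∸ j₂) (λ j₃ → σ₂ (suc j₂) j₃ (suc j)))  ∎
    where
    open ≡-Reasoning
    γ₁ = drop (suc j) β
    T = reaches j i₁ β
    f = λ j₂ → multichoose (s₁′ ∸ j) j₂ * zeroPrefix (s₁′ ∸ j + j₂) γ₁ * mult (y^ (k ∸ j₂)) (wordOf (b₂ ∷ zs)) (wordOf (drop (s₁′ ∸ j + j₂) γ₁))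

  term₂-eq : c₂ * Σ< s₁′ (λ j → reaches j i₁ β * mult (y^ k) (wordOf (replicate (s₁′ ∸ j) 0 ++ b₂ ∷ zs)) (wordOf (drop (suc j) β)))
             ≡ sumR 1 (suc k) (λ r₁ → sumR 0 (suc k ∸ r₁) (λ r₂ → sumR 1 (suc s₁′ ∸ 1)
                 (σ₂ r₁ r₂)))
  term₂-eq = begin
    c₂ * Σ< s₁′ (λ j → reaches j i₁ β * mult (y^ k) (wordOf (replicate (s₁′ ∸ j) 0 ++ b₂ ∷ zs)) (wordOf (drop (suc j) β)))
      ≡⟨ *-Σ< c₂ s₁′ _ _ term₂-middle ⟩
    Σ< s₁′ (λ j → Σ≤ k (λ j₂ → Σ≤ (k ∸ j₂) (λ j₃ → σ₂ (suc j₂) j₃ (suc j))))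
      ≡⟨ Σ<-swap s₁′ (suc k) (λ j j₂ → Σ≤ (k ∸ j₂) (λ j₃ → σ₂ (suc j₂) j₃ (suc j))) ⟩
    Σ≤ k (λ j₂ → Σ< s₁′ (λ j → Σ≤ (k ∸ j₂) (λ j₃ → σ₂ (suc j₂) j₃ (suc j))))
      ≡⟨ Σ<-cong (suc k) (λ j₂ → trans (Σ<-swap s₁′ (suc (k ∸ j₂)) (λ j j₃ → σ₂ (suc j₂) j₃ (suc j)))
                                       (trans (Σ<-cong (suc (k ∸ j₂)) (λ j₃ → sym (sumR≡Σ< 1 s₁′ (σ₂ (suc j₂) j₃))))
                                              (sym (sumR≡Σ< 0 (k ∸ j₂) (λ j₃ → sumR 1 s₁′ (σ₂ (suc j₂) j₃)))))) ⟩
    Σ≤ k (λ j₂ → sumR 0 (k ∸ j₂) (λ j₃ → sumR 1 s₁′ (σ₂ (suc j₂) j₃)))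
      ≡⟨ sym (sumR≡Σ< 1 (suc k) _) ⟩
    sumR 1 (suc k) (λ r₁ → sumR 0 (suc k ∸ r₁) (λ r₂ → sumR 1 s₁′ (σ₂ r₁ r₂)))  ∎
    where open ≡-Reasoning

  -- c = α_{s₁+1} is the entry holding the x's of v's second block.
  module Tail (c : ℕ) (β₂ : List ℕ) (drop≡ : drop s₁′ β ≡ c ∷ β₂) where
    S = sum (take s₁′ β)
    ps = α₁ + S
    i₂ = remainder s₁′ i₁ β
    i₃ = i₂ + b₂ ∸ c

    i₂≡ : i₂ ≡ A ∸ ps
    i₂≡ = trans (remainder-spec s₁′ i₁ β) (∸-+-assoc A α₁ S)

    length-β′ : length β ≡ s₁′ + suc (k + suc s₂′)
    length-β′ = trans length-β (arith k s₁′ s₂′)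
      where
      arith : ∀ k s₁′ s₂′ → k + suc s₁′ + suc s₂′ ≡ s₁′ + suc (k + suc s₂′)
      arith = solve-∀

    length-β₂ : length β₂ ≡ k + suc s₂′
    length-β₂ = suc-injective (trans (cong length (sym drop≡)) (length-drop-+ s₁′ _ β length-β′))

    length-β₂′ : length β₂ ≡ s₂′ + suc k
    length-β₂′ = trans length-β₂ (trans (+-suc k s₂′) (trans (cong suc (+-comm k s₂′)) (sym (+-suc s₂′ k))))

    prefix : leNat α₁ A * fitsIn s₁′ i₁ β ≡ leNat ps A
    prefix = trans (cong (leNat α₁ A *_) (fitsIn-length s₁′ _ i₁ β length-β′)) (leNat*leNat-∸ α₁ S A)

    at≡c : at α (suc s₁′ + 1) ≡ c
    at≡c = at-∷-≡ α₁ β s₁′ drop≡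

    drop-β₂ : ∀ j → drop (s₁′ + suc (suc j)) β ≡ drop (suc j) β₂
    drop-β₂ j = trans (sym (drop-drop s₁′ (suc (suc j)) β)) (cong (drop (suc (suc j))) drop≡)

    total-β₂ : ∀ p → ps + (c + sum (take p β₂)) + sum (drop p β₂) ≡ A + b₂
    total-β₂ p = begin
      α₁ + S + (c + sum (take p β₂)) + sum (drop p β₂)   ≡⟨ regroup α₁ S c (sum (take p β₂)) _ ⟩
      α₁ + (S + (c + (sum (take p β₂) + sum (drop p β₂)))) ≡⟨ cong (λ t → α₁ + (S + (c + t))) (sum-take+drop p β₂) ⟩
      α₁ + (S + sum (c ∷ β₂))                          ≡⟨ cong (λ γ → α₁ + (S + sum γ)) (sym drop≡) ⟩
      α₁ + (S + sum (drop s₁′ β))                      ≡⟨ cong (α₁ +_) (sum-take+drop s₁′ β) ⟩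
      α₁ + sum β                                       ≡⟨ total ⟩
      A + b₂                                           ∎
      where
      open ≡-Reasoning
      regroup : ∀ a s c t d → a + s + (c + t) + d ≡ a + (s + (c + (t + d)))
      regroup = solve-∀

    head-indicators : ∀ j e → length β₂ ≡ suc j + e →
      leNat α₁ A * fitsIn s₁′ i₁ β * (leNat c (i₂ + b₂) * reaches j i₃ β₂)
        ≡ leNat ps A * eqNat (c + sum (take (suc j) β₂)) (A ∸ ps + b₂)
    head-indicators j e h = cong₂ _*_ prefix
      (trans (cong (leNat c (i₂ + b₂) *_) (reaches-length j e i₃ β₂ h))
             (trans (leNat*eqNat-∸ c _ (i₂ + b₂)) (cong (λ i → eqNat (c + sum (take (suc j) β₂)) (i + b₂)) i₂≡)))

    D0-tail : ∀ j {P e} → P ≡ s₁′ + suc (suc j) → suc k + suc s₁′ + suc s₂′ ≡ P + 1 + e → length (drop (suc j) β₂) ≡ e →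
              D0 α (P + 2) (suc k + suc s₁′ + suc s₂′) ≡ eqNat (sum (drop (suc j) β₂)) 0
    D0-tail j refl n≡ h = trans (cong (D0 α (s₁′ + suc (suc j) + 2)) n≡)
      (trans (D0-suffix α₁ β (s₁′ + suc (suc j)) _ (trans (cong length (drop-β₂ j)) h))
             (cong (λ γ → eqNat (sum γ) 0) (drop-β₂ j)))

    term₃-summand : ∀ j → j ≤ k →
      c₂ * fitsIn s₁′ i₁ β * ((c C i₂) * leNat c (i₂ + b₂))
        * (reaches j i₃ β₂ * mult (y^ (k ∸ j)) (wordOf zs) (wordOf (drop (suc j) β₂)))
      ≡ σ₃ (suc j)
    term₃-summand j j≤k = begin
      c₂ * F * ((c C i₂) * L) * (T * mult (y^ K) (wordOf zs) (wordOf γ))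
        ≡⟨ cong (λ t → c₂ * F * ((c C i₂) * L) * (T * t)) (mult-y^-zs K (wordOf γ)) ⟩
      c₂ * F * ((c C i₂) * L) * (T * (((K + s₂′) C K) * E))
        ≡⟨ regroup (α₁ C b₁) (leNat α₁ A) F (c C i₂) L T ((K + s₂′) C K) E ⟩
      (α₁ C b₁) * (c C i₂) * ((K + s₂′) C K) * (leNat α₁ A * F * (L * T) * E)
        ≡⟨ cong₂ (λ p q → (α₁ C b₁) * p * ((K + s₂′) C K) * q) (cong (c C_) i₂≡)
                 (cong₂ _*_ (head-indicators j (K + s₂′) length-β₂ⱼ) (eqWord-y^-wordOf (K + s₂′) γ length-γ)) ⟩
      (α₁ C b₁) * (c C (A ∸ ps)) * ((K + s₂′) C K) * (leNat ps A * eqNat (c + S′) (A ∸ ps + b₂) * eqNat (sum γ) 0)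
        ≡⟨ cong ((α₁ C b₁) * (c C (A ∸ ps)) * ((K + s₂′) C K) *_)
                (leNat-eqNat-implied ps (c + S′) (sum γ) A b₂ (total-β₂ (suc j))) ⟩
      (α₁ C b₁) * (c C (A ∸ ps)) * ((K + s₂′) C K) * (leNat ps A * eqNat (sum γ) 0)
        ≡⟨ regroup′ (α₁ C b₁) (c C (A ∸ ps)) ((K + s₂′) C K) (leNat ps A) (eqNat (sum γ) 0) ⟩
      (α₁ C b₁) * (leNat ps A * (c C (A ∸ ps))) * ((K + s₂′) C K) * eqNat (sum γ) 0
        ≡⟨ cong₂ (λ p q → (α₁ C b₁) * p * q * eqNat (sum γ) 0)
                 (sym (trans (cong (λ x → binom (+ x) (+ A ℤ.- + ps)) at≡c) (binom-lower-minus c A ps)))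
                 (sym (binom-r+s-1 s₂′ K)) ⟩
      (α₁ C b₁) * binom (+ at α (suc s₁′ + 1)) (+ A ℤ.- + ps) * binom (+ K ℤ.+ + suc s₂′ ℤ.- + 1) (+ K) * eqNat (sum γ) 0
        ≡⟨ cong ((α₁ C b₁) * binom (+ at α (suc s₁′ + 1)) (+ A ℤ.- + ps) * binom (+ K ℤ.+ + suc s₂′ ℤ.- + 1) (+ K) *_)
                (sym (D0-tail j (arith₁ j s₁′) (trans (cong (λ k → suc k + suc s₁′ + suc s₂′) k≡) (arith₂ j K s₁′ s₂′)) length-γ)) ⟩
      σ₃ (suc j)  ∎
      where
      open ≡-Reasoning
      open import Data.Integer using (+_)
      K = k ∸ j
      k≡ : k ≡ j + K
      k≡ = sym (m+[n∸m]≡n j≤k)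
      γ = drop (suc j) β₂
      S′ = sum (take (suc j) β₂)
      F = fitsIn s₁′ i₁ β
      L = leNat c (i₂ + b₂)
      T = reaches j i₃ β₂
      E = eqWord (y^ (K + s₂′)) (wordOf γ)
      length-β₂ⱼ : length β₂ ≡ suc j + (K + s₂′)
      length-β₂ⱼ = trans length-β₂ (trans (cong (λ k → k + suc s₂′) k≡) (arith j K s₂′))
        where
        arith : ∀ j K s₂′ → j + K + suc s₂′ ≡ suc j + (K + s₂′)
        arith = solve-∀
      length-γ : length γ ≡ K + s₂′
      length-γ = length-drop-+ (suc j) _ β₂ length-β₂ⱼ
      regroup : ∀ a l f c m t d e → a * l * f * (c * m) * (t * (d * e)) ≡ a * c * d * (l * f * (m * t) * e)
      regroup = solve-∀
      regroup′ : ∀ a c d l e → a * c * d * (l * e) ≡ a * (l * c) * d * e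
      regroup′ = solve-∀
      arith₁ : ∀ j s₁′ → suc j + suc s₁′ ≡ s₁′ + suc (suc j)
      arith₁ = solve-∀
      arith₂ : ∀ j K s₁′ s₂′ → suc (j + K) + suc s₁′ + suc s₂′ ≡ suc j + suc s₁′ + 1 + (K + s₂′)
      arith₂ = solve-∀

    term₃-eq : c₂ * (fitsIn s₁′ i₁ β * ((c C i₂) * leNat c (i₂ + b₂) * mult (y^ k) (wordOf (i₃ ∷ zs)) (wordOf β₂)))
               ≡ sumR 1 (suc k) (σ₃)
    term₃-eq = begin
      c₂ * (F * (w₂ * mult (y^ k) (wordOf (i₃ ∷ zs)) (wordOf β₂)))
        ≡⟨ cong (λ t → c₂ * (F * (w₂ * t))) (mult-y^-wordOf k i₃ zs β₂) ⟩
      c₂ * (F * (w₂ * Σ≤ k f))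
        ≡⟨ regroup c₂ F w₂ (Σ≤ k f) ⟩
      c₂ * F * w₂ * Σ≤ k f
        ≡⟨ *-Σ≤ (c₂ * F * w₂) k f _ term₃-summand ⟩
      Σ≤ k (λ j → σ₃ (suc j))
        ≡⟨ sym (sumR≡Σ< 1 (suc k) _) ⟩
      sumR 1 (suc k) (σ₃)  ∎
      where
      open ≡-Reasoning
      F = fitsIn s₁′ i₁ β
      w₂ = (c C i₂) * leNat c (i₂ + b₂)
      f = λ j → reaches j i₃ β₂ * mult (y^ (k ∸ j)) (wordOf zs) (wordOf (drop (suc j) β₂))
      regroup : ∀ p q r s → p * (q * (r * s)) ≡ p * q * r * s
      regroup = solve-∀

    term₄-summand : ∀ j → j < s₂′ →
      c₂ * fitsIn s₁′ i₁ β * ((c C b₂) * leNat c (i₂ + b₂))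
        * (reaches j i₃ β₂ * mult (y^ k) (wordOf (replicate (s₂′ ∸ j) 0 ++ [])) (wordOf (drop (suc j) β₂)))
      ≡ σ₄ (suc j)
    term₄-summand j j<s₂′ = begin
      c₂ * F * ((c C b₂) * L) * (T * mult (y^ k) (wordOf (replicate e 0 ++ [])) (wordOf γ))
        ≡⟨ cong (λ t → c₂ * F * ((c C b₂) * L) * (T * t))
                (trans (cong (λ v → mult (y^ k) v (wordOf γ)) (trans (cong wordOf (++-identityʳ (replicate e 0))) (wordOf-zeros e)))
                       (mult-y^-y^ k e (wordOf γ))) ⟩
      c₂ * F * ((c C b₂) * L) * (T * (((k + e) C k) * E))
        ≡⟨ regroup (α₁ C b₁) (leNat α₁ A) F (c C b₂) L T ((k + e) C k) E ⟩
      (α₁ C b₁) * ((k + e) C k) * ((c C b₂) * (leNat α₁ A * F * (L * T) * E))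
        ≡⟨ cong (λ t → (α₁ C b₁) * ((k + e) C k) * ((c C b₂) * t))
                (cong₂ _*_ (head-indicators j (k + e) length-β₂ⱼ) (eqWord-y^-wordOf (k + e) γ length-γ)) ⟩
      (α₁ C b₁) * ((k + e) C k) * ((c C b₂) * (leNat ps A * eqNat (c + S′) (A ∸ ps + b₂) * eqNat (sum γ) 0))
        ≡⟨ cong ((α₁ C b₁) * ((k + e) C k) *_)
                (C*-cong-≤ c b₂ (λ b₂≤c → leNat-eqNat-forced ps (c + S′) (sum γ) A b₂ (total-β₂ (suc j)) (≤-trans b₂≤c (m≤m+n c S′)))) ⟩
      (α₁ C b₁) * ((k + e) C k) * ((c C b₂) * eqNat (sum γ) 0)
        ≡⟨ regroup′ (α₁ C b₁) ((k + e) C k) (c C b₂) (eqNat (sum γ) 0) ⟩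
      (α₁ C b₁) * (c C b₂) * ((k + e) C k) * eqNat (sum γ) 0
        ≡⟨ cong₂ (λ p q → (α₁ C b₁) * p * q * eqNat (sum γ) 0)
                 (cong (λ x → binom (+ x) (+ b₂)) (sym at≡c))
                 (sym (trans (cong (λ s → binom (+ suc k ℤ.+ + suc s ℤ.- + suc j ℤ.- + 1) (+ suc k ℤ.- + 1)) s₂′≡)
                             (binom-r+s-l-1 k j e))) ⟩
      (α₁ C b₁) * binom (+ at α (suc s₁′ + 1)) (+ b₂) * binom (+ suc k ℤ.+ + suc s₂′ ℤ.- + suc j ℤ.- + 1) (+ suc k ℤ.- + 1) * eqNat (sum γ) 0
        ≡⟨ cong ((α₁ C b₁) * binom (+ at α (suc s₁′ + 1)) (+ b₂) * binom (+ suc k ℤ.+ + suc s₂′ ℤ.- + suc j ℤ.- + 1) (+ suc k ℤ.- + 1) *_)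
                (sym (D0-tail j (arith₁ j s₁′) (trans (cong (λ s → suc k + suc s₁′ + suc s) s₂′≡) (arith₂ j e k s₁′)) length-γ)) ⟩
      σ₄ (suc j)  ∎
      where
      open ≡-Reasoning
      open import Data.Integer using (+_)
      e = s₂′ ∸ j
      s₂′≡ : s₂′ ≡ j + e
      s₂′≡ = sym (m+[n∸m]≡n (<⇒≤ j<s₂′))
      γ = drop (suc j) β₂
      S′ = sum (take (suc j) β₂)
      F = fitsIn s₁′ i₁ β
      L = leNat c (i₂ + b₂)
      T = reaches j i₃ β₂
      E = eqWord (y^ (k + e)) (wordOf γ)
      length-β₂ⱼ : length β₂ ≡ suc j + (k + e)
      length-β₂ⱼ = trans length-β₂ (trans (cong (λ s → k + suc s) s₂′≡) (arith j e k))
        where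
        arith : ∀ j e k → k + suc (j + e) ≡ suc j + (k + e)
        arith = solve-∀
      length-γ : length γ ≡ k + e
      length-γ = length-drop-+ (suc j) _ β₂ length-β₂ⱼ
      regroup : ∀ a l f c m t d g → a * l * f * (c * m) * (t * (d * g)) ≡ a * d * (c * (l * f * (m * t) * g))
      regroup = solve-∀
      regroup′ : ∀ a d c g → a * d * (c * g) ≡ a * c * d * g
      regroup′ = solve-∀
      arith₁ : ∀ j s₁′ → suc s₁′ + suc j ≡ s₁′ + suc (suc j)
      arith₁ = solve-∀
      arith₂ : ∀ j e k s₁′ → suc k + suc s₁′ + suc (j + e) ≡ suc s₁′ + suc j + 1 + (k + e)
      arith₂ = solve-∀

    last-indicators : ∀ h → leNat c (i₂ + b₂) * (fitsIn s₂′ i₃ β₂ * eqNat h (remainder s₂′ i₃ β₂))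
                            ≡ eqNat (c + (sum (take s₂′ β₂) + h)) (A ∸ ps + b₂)
    last-indicators h = begin
      leNat c (i₂ + b₂) * (fitsIn s₂′ i₃ β₂ * eqNat h (remainder s₂′ i₃ β₂))
        ≡⟨ cong₂ (λ f r → leNat c (i₂ + b₂) * (f * eqNat h r))
                 (fitsIn-length s₂′ (suc k) i₃ β₂ length-β₂′) (remainder-spec s₂′ i₃ β₂) ⟩
      leNat c (i₂ + b₂) * (leNat S₂ i₃ * eqNat h (i₃ ∸ S₂))
        ≡⟨ cong (leNat c (i₂ + b₂) *_) (leNat*eqNat-∸ S₂ h i₃) ⟩
      leNat c (i₂ + b₂) * eqNat (S₂ + h) i₃
        ≡⟨ leNat*eqNat-∸ c (S₂ + h) (i₂ + b₂) ⟩
      eqNat (c + (S₂ + h)) (i₂ + b₂)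
        ≡⟨ cong (λ i → eqNat (c + (S₂ + h)) (i + b₂)) i₂≡ ⟩
      eqNat (c + (S₂ + h)) (A ∸ ps + b₂)  ∎
      where
      open ≡-Reasoning
      S₂ = sum (take s₂′ β₂)

    total-last : ∀ h D₁ → drop s₂′ β₂ ≡ h ∷ D₁ → ps + (c + (sum (take s₂′ β₂) + h)) + sum D₁ ≡ A + b₂
    total-last h D₁ D≡ =
      trans (regroup ps c (sum (take s₂′ β₂)) h (sum D₁))
            (trans (cong (λ γ → ps + (c + sum (take s₂′ β₂)) + sum γ) (sym D≡)) (total-β₂ s₂′))
      where
      regroup : ∀ p c s h d → p + (c + (s + h)) + d ≡ p + (c + s) + (h + d)
      regroup = solve-∀

    term₄-last : ∀ h D₁ → drop s₂′ β₂ ≡ h ∷ D₁ →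
      c₂ * fitsIn s₁′ i₁ β * ((c C b₂) * leNat c (i₂ + b₂))
        * (fitsIn s₂′ i₃ β₂ * mult (x^ (remainder s₂′ i₃ β₂) ++ y^ (suc k)) (wordOf []) (wordOf (drop s₂′ β₂)))
      ≡ σ₄ (suc s₂′)
    term₄-last h D₁ D≡ = begin
      c₂ * F * ((c C b₂) * L) * (F₂ * mult (x^ i₄ ++ y^ (suc k)) [] (wordOf (drop s₂′ β₂)))
        ≡⟨ cong (λ t → c₂ * F * ((c C b₂) * L) * (F₂ * t))
                (trans (mult-[]ʳ (x^ i₄ ++ y^ (suc k)) _) (trans (cong (λ γ → eqWord (x^ i₄ ++ y^ (suc k)) (wordOf γ)) D≡)
                       (eqWord-x^y^-wordOf i₄ k h D₁ length-D₁))) ⟩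
      c₂ * F * ((c C b₂) * L) * (F₂ * (eqNat h i₄ * eqNat (sum D₁) 0))
        ≡⟨ regroup (α₁ C b₁) (leNat α₁ A) F (c C b₂) L F₂ (eqNat h i₄) (eqNat (sum D₁) 0) ⟩
      (α₁ C b₁) * ((c C b₂) * (leNat α₁ A * F * (L * (F₂ * eqNat h i₄)) * eqNat (sum D₁) 0))
        ≡⟨ cong (λ t → (α₁ C b₁) * ((c C b₂) * (t * eqNat (sum D₁) 0))) (cong₂ _*_ prefix (last-indicators h)) ⟩
      (α₁ C b₁) * ((c C b₂) * (leNat ps A * eqNat (c + (S₂ + h)) (A ∸ ps + b₂) * eqNat (sum D₁) 0))
        ≡⟨ cong ((α₁ C b₁) *_)
                (C*-cong-≤ c b₂ (λ b₂≤c → leNat-eqNat-forced ps (c + (S₂ + h)) (sum D₁) A b₂ (total-last h D₁ D≡) (≤-trans b₂≤c (m≤m+n c _)))) ⟩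
      (α₁ C b₁) * ((c C b₂) * eqNat (sum D₁) 0)
        ≡⟨ regroup′ (α₁ C b₁) (c C b₂) (eqNat (sum D₁) 0) ⟩
      (α₁ C b₁) * (c C b₂) * 1 * eqNat (sum D₁) 0
        ≡⟨ cong₂ (λ p q → (α₁ C b₁) * p * q * eqNat (sum D₁) 0) (cong (λ x → binom (+ x) (+ b₂)) (sym at≡c)) (sym (binom-r+s-s-1≡1 k s₂′)) ⟩
      (α₁ C b₁) * binom (+ at α (suc s₁′ + 1)) (+ b₂) * binom (+ suc k ℤ.+ + suc s₂′ ℤ.- + suc s₂′ ℤ.- + 1) (+ suc k ℤ.- + 1)
        * eqNat (sum D₁) 0
        ≡⟨ cong ((α₁ C b₁) * binom (+ at α (suc s₁′ + 1)) (+ b₂) * binom (+ suc k ℤ.+ + suc s₂′ ℤ.- + suc s₂′ ℤ.- + 1) (+ suc k ℤ.- + 1) *_)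
                (sym (trans (D0-tail s₂′ (arith₁ s₂′ s₁′) (arith₂ k s₁′ s₂′) (trans (cong length drop-suc≡) length-D₁))
                            (cong (λ γ → eqNat (sum γ) 0) drop-suc≡))) ⟩
      σ₄ (suc s₂′)  ∎
      where
      open ≡-Reasoning
      open import Data.Integer using (+_)
      S₂ = sum (take s₂′ β₂)
      i₄ = remainder s₂′ i₃ β₂
      F = fitsIn s₁′ i₁ β
      F₂ = fitsIn s₂′ i₃ β₂
      L = leNat c (i₂ + b₂)
      length-D₁ : length D₁ ≡ k
      length-D₁ = suc-injective (trans (cong length (sym D≡)) (length-drop-+ s₂′ (suc k) β₂ length-β₂′))
      drop-suc≡ : drop (suc s₂′) β₂ ≡ D₁
      drop-suc≡ = trans (cong (λ p → drop p β₂) (+-comm 1 s₂′)) (trans (sym (drop-drop s₂′ 1 β₂)) (cong (drop 1) D≡))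
      regroup : ∀ a l f c m f₂ e d → a * l * f * (c * m) * (f₂ * (e * d)) ≡ a * (c * (l * f * (m * (f₂ * e)) * d))
      regroup = solve-∀
      regroup′ : ∀ a c d → a * (c * d) ≡ a * c * 1 * d
      regroup′ = solve-∀
      arith₁ : ∀ s₂′ s₁′ → suc s₁′ + suc s₂′ ≡ s₁′ + suc (suc s₂′)
      arith₁ = solve-∀
      arith₂ : ∀ k s₁′ s₂′ → suc k + suc s₁′ + suc s₂′ ≡ suc s₁′ + suc s₂′ + 1 + k
      arith₂ = solve-∀

    Q = Σ< s₂′ (λ j → reaches j i₃ β₂ * mult (y^ k) (wordOf (replicate (s₂′ ∸ j) 0 ++ [])) (wordOf (drop (suc j) β₂)))
        + fitsIn s₂′ i₃ β₂ * mult (x^ (remainder s₂′ i₃ β₂) ++ y^ (suc k)) (wordOf []) (wordOf (drop s₂′ β₂))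

    term₄-eq : c₂ * (fitsIn s₁′ i₁ β * ((c C b₂) * leNat c (i₂ + b₂) * Q))
               ≡ sumR 1 (suc s₂′) σ₄
    term₄-eq with cons-of-length (drop s₂′ β₂) (length-drop-+ s₂′ (suc k) β₂ length-β₂′)
    ... | h , D₁ , D≡ = begin
      c₂ * (F * (w * (Σ< s₂′ g + t)))
        ≡⟨ distrib c₂ F w (Σ< s₂′ g) t ⟩
      c₂ * F * w * Σ< s₂′ g + c₂ * F * w * t
        ≡⟨ cong₂ _+_ (*-Σ< (c₂ * F * w) s₂′ g _ term₄-summand) (term₄-last h D₁ D≡) ⟩
      Σ< s₂′ (summand ∘ suc) + summand (suc s₂′)
        ≡⟨ sym (Σ<-suc s₂′ (summand ∘ suc)) ⟩
      Σ≤ s₂′ (summand ∘ suc)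
        ≡⟨ sym (sumR≡Σ< 1 (suc s₂′) summand) ⟩
      sumR 1 (suc s₂′) summand  ∎
      where
      open ≡-Reasoning
      summand = σ₄
      F = fitsIn s₁′ i₁ β
      w = (c C b₂) * leNat c (i₂ + b₂)
      g = λ j → reaches j i₃ β₂ * mult (y^ k) (wordOf (replicate (s₂′ ∸ j) 0 ++ [])) (wordOf (drop (suc j) β₂))
      t = fitsIn s₂′ i₃ β₂ * mult (x^ (remainder s₂′ i₃ β₂) ++ y^ (suc k)) (wordOf []) (wordOf (drop s₂′ β₂))
      distrib : ∀ p q r s u → p * (q * (r * (s + u))) ≡ p * q * r * s + p * q * r * u
      distrib = solve-∀

    expansion : mult (x^ a ++ y^ (suc k)) (wordOf (b₁ ∷ R)) (wordOf (α₁ ∷ β))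
      ≡ c₁ * mult (y^ k) (wordOf (i₁ ∷ R)) (wordOf β)
        + c₂ * (Σ< s₁′ (λ j → reaches j i₁ β * mult (y^ k) (wordOf (replicate (s₁′ ∸ j) 0 ++ b₂ ∷ zs)) (wordOf (drop (suc j) β)))
                + fitsIn s₁′ i₁ β * ((c C i₂) * leNat c (i₂ + b₂) * mult (y^ k) (wordOf (i₃ ∷ zs)) (wordOf β₂)
                                     + (c C b₂) * leNat c (i₂ + b₂) * Q))
    expansion = begin
      mult (x^ a ++ y^ (suc k)) (wordOf (b₁ ∷ R)) (wordOf (α₁ ∷ β))
        ≡⟨ mult-x^y^-wordOf a k b₁ R α₁ β ⟩
      c₁ * mult (y^ k) (wordOf (i₁ ∷ R)) (wordOf β) + c₂ * mult (x^ i₁ ++ y^ (suc k)) (wordOf R) (wordOf β)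
        ≡⟨ cong (λ t → c₁ * mult (y^ k) (wordOf (i₁ ∷ R)) (wordOf β) + c₂ * t) (begin
          mult (x^ i₁ ++ y^ (suc k)) (wordOf R) (wordOf β)
            ≡⟨ mult-x^y^-zeros s₁′ i₁ k (b₂ ∷ zs) β ⟩
          P₂ + fitsIn s₁′ i₁ β * mult (x^ i₂ ++ y^ (suc k)) (wordOf (b₂ ∷ zs)) (wordOf (drop s₁′ β))
            ≡⟨ cong (λ γ → P₂ + fitsIn s₁′ i₁ β * mult (x^ i₂ ++ y^ (suc k)) (wordOf (b₂ ∷ zs)) (wordOf γ)) drop≡ ⟩
          P₂ + fitsIn s₁′ i₁ β * mult (x^ i₂ ++ y^ (suc k)) (wordOf (b₂ ∷ zs)) (wordOf (c ∷ β₂))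
            ≡⟨ cong (λ t → P₂ + fitsIn s₁′ i₁ β * t) (mult-x^y^-wordOf i₂ k b₂ zs c β₂) ⟩
          P₂ + fitsIn s₁′ i₁ β * (P₃ + (c C b₂) * leNat c (i₂ + b₂) * mult (x^ i₃ ++ y^ (suc k)) (wordOf zs) (wordOf β₂))
            ≡⟨ cong (λ t → P₂ + fitsIn s₁′ i₁ β * (P₃ + (c C b₂) * leNat c (i₂ + b₂) * t))
                    (trans (cong (λ γ → mult (x^ i₃ ++ y^ (suc k)) (wordOf γ) (wordOf β₂)) (sym (++-identityʳ zs)))
                           (mult-x^y^-zeros s₂′ i₃ k [] β₂)) ⟩
          P₂ + fitsIn s₁′ i₁ β * (P₃ + (c C b₂) * leNat c (i₂ + b₂) * Q)  ∎) ⟩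
      c₁ * mult (y^ k) (wordOf (i₁ ∷ R)) (wordOf β) + c₂ * (P₂ + fitsIn s₁′ i₁ β * (P₃ + (c C b₂) * leNat c (i₂ + b₂) * Q))  ∎
      where
      open ≡-Reasoning
      P₂ = Σ< s₁′ (λ j → reaches j i₁ β * mult (y^ k) (wordOf (replicate (s₁′ ∸ j) 0 ++ b₂ ∷ zs)) (wordOf (drop (suc j) β)))
      P₃ = (c C i₂) * leNat c (i₂ + b₂) * mult (y^ k) (wordOf (i₃ ∷ zs)) (wordOf β₂)

xy++xy≡wordOf : ∀ b₁ b₂ s₁′ s₂′ →
  xy b₁ (suc s₁′) ++ xy b₂ (suc s₂′) ≡ wordOf (b₁ ∷ replicate s₁′ 0 ++ b₂ ∷ replicate s₂′ 0)
xy++xy≡wordOf b₁ b₂ s₁′ s₂′ = sym (begin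
  wordOf (b₁ ∷ replicate s₁′ 0 ++ b₂ ∷ replicate s₂′ 0)
    ≡⟨ wordOf-∷ b₁ (replicate s₁′ 0 ++ b₂ ∷ replicate s₂′ 0) ⟩
  x^ b₁ ++ y ∷ wordOf (replicate s₁′ 0 ++ b₂ ∷ replicate s₂′ 0)
    ≡⟨ cong (λ w → x^ b₁ ++ y ∷ w) (trans (wordOf-zeros++ s₁′ (b₂ ∷ replicate s₂′ 0))
         (cong (y^ s₁′ ++_) (trans (wordOf-∷ b₂ (replicate s₂′ 0)) (cong (λ w → x^ b₂ ++ y ∷ w) (wordOf-zeros s₂′))))) ⟩
  x^ b₁ ++ y ∷ (y^ s₁′ ++ (x^ b₂ ++ y ∷ y^ s₂′))
    ≡⟨ sym (++-assoc (x^ b₁) (y ∷ y^ s₁′) _) ⟩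
  xy b₁ (suc s₁′) ++ xy b₂ (suc s₂′)  ∎)
  where open ≡-Reasoning

mult-xy-xyxy : ∀ a b₁ b₂ k s₁′ s₂′ β → length β ≡ suc k + suc s₁′ + suc s₂′ → sum β ≡ a + b₁ + b₂ →
  mult (xy a (suc k)) (xy b₁ (suc s₁′) ++ xy b₂ (suc s₂′)) (wordOf β) ≡ coef a b₁ b₂ (suc k) (suc s₁′) (suc s₂′) β
mult-xy-xyxy a b₁ b₂ k s₁′ s₂′ (α₁ ∷ β) length-α total
  with cons-of-length (drop s₁′ β) (length-drop-+ s₁′ _ β (length-β′ (suc-injective length-α)))
  where
  length-β′ : length β ≡ k + suc s₁′ + suc s₂′ → length β ≡ s₁′ + suc (k + suc s₂′)
  length-β′ h = trans h (arith k s₁′ s₂′)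
    where
    arith : ∀ k s₁′ s₂′ → k + suc s₁′ + suc s₂′ ≡ s₁′ + suc (k + suc s₂′)
    arith = solve-∀
... | c , β₂ , drop≡ = begin
  mult (xy a (suc k)) (xy b₁ (suc s₁′) ++ xy b₂ (suc s₂′)) (wordOf (α₁ ∷ β))
    ≡⟨ cong (λ v → mult (xy a (suc k)) v (wordOf (α₁ ∷ β))) (xy++xy≡wordOf b₁ b₂ s₁′ s₂′) ⟩
  mult (x^ a ++ y^ (suc k)) (wordOf (b₁ ∷ R)) (wordOf (α₁ ∷ β))
    ≡⟨ expansion ⟩
  c₁ * P₁ + c₂ * (P₂ + F * (P₃ + w * Q))
    ≡⟨ distribute (c₁ * P₁) c₂ P₂ F P₃ w Q ⟩
  c₁ * P₁ + c₂ * P₂ + c₂ * (F * P₃) + c₂ * (F * (w * Q))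
    ≡⟨ cong₂ _+_ (cong₂ _+_ (cong₂ _+_ term₁-eq term₂-eq) term₃-eq) term₄-eq ⟩
  coef a b₁ b₂ (suc k) (suc s₁′) (suc s₂′) (α₁ ∷ β)  ∎
  where
  open ≡-Reasoning
  open Expansion a b₁ b₂ k s₁′ s₂′ α₁ β (suc-injective length-α) total
  open Tail c β₂ drop≡
  P₁ = mult (y^ k) (wordOf (i₁ ∷ R)) (wordOf β)
  P₂ = Σ< s₁′ (λ j → reaches j i₁ β * mult (y^ k) (wordOf (replicate (s₁′ ∸ j) 0 ++ b₂ ∷ zs)) (wordOf (drop (suc j) β)))
  F = fitsIn s₁′ i₁ β
  P₃ = (c C i₂) * leNat c (i₂ + b₂) * mult (y^ k) (wordOf (i₃ ∷ zs)) (wordOf β₂)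
  w = (c C b₂) * leNat c (i₂ + b₂)
  distribute : ∀ t c p f q w r → t + c * (p + f * (q + w * r)) ≡ t + c * p + c * (f * q) + c * (f * (w * r))
  distribute = solve-∀

proposition3p2 : (a b₁ b₂ r s₁ s₂ : ℕ) → 1 ≤ r → 1 ≤ s₁ → 1 ≤ s₂ →
    (w : Word) →
    coeff (mon (xy a r) ⧢ mon (xy b₁ s₁ ++ xy b₂ s₂)) w ≡ coeff (rhs a b₁ b₂ r s₁ s₂) w
proposition3p2 a b₁ b₂ (suc k) (suc s₁′) (suc s₂′) _ _ _ w with wordOf++x^-decomposition w
... | β , t , refl = begin
  coeff (mon u ⧢ mon v) (wordOf β ++ x^ t)
    ≡⟨ coeff-mon⧢mon u v _ ⟩
  mult u v (wordOf β ++ x^ t)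
    ≡⟨ mult-wordOf++x^ u v ends-u ends-v occ-y≡ occ-x≡ (coef a b₁ b₂ (suc k) (suc s₁′) (suc s₂′)) β t
                       (mult-xy-xyxy a b₁ b₂ k s₁′ s₂′ β) ⟩
  eqNat t 0 * (eqNat (length β) (suc k + suc s₁′ + suc s₂′) * (eqNat (sum β) (a + b₁ + b₂) * coef a b₁ b₂ (suc k) (suc s₁′) (suc s₂′) β))
    ≡⟨ sym (coeff-rhs a b₁ b₂ (suc k) (suc s₁′) (suc s₂′) β t) ⟩
  coeff (rhs a b₁ b₂ (suc k) (suc s₁′) (suc s₂′)) (wordOf β ++ x^ t)  ∎
  where
  open ≡-Reasoning
  u = xy a (suc k)
  v = xy b₁ (suc s₁′) ++ xy b₂ (suc s₂′)
  ends-u : EndsInY u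
  ends-u = EndsInY-++y (x^ a) (y^ k) (subst EndsInY (wordOf-zeros k) (EndsInY-wordOf (replicate k 0)))
  ends-v : EndsInY v
  ends-v = subst EndsInY (sym (xy++xy≡wordOf b₁ b₂ s₁′ s₂′)) (EndsInY-wordOf (b₁ ∷ replicate s₁′ 0 ++ b₂ ∷ replicate s₂′ 0))
  occ-y≡ : occ y u + occ y v ≡ suc k + suc s₁′ + suc s₂′
  occ-y≡ = trans (cong₂ _+_ (occ-y-xy a (suc k)) (trans (occ-++ y (xy b₁ (suc s₁′)) _) (cong₂ _+_ (occ-y-xy b₁ _) (occ-y-xy b₂ _))))
                 (sym (+-assoc (suc k) (suc s₁′) (suc s₂′)))
  occ-x≡ : occ x u + occ x v ≡ a + b₁ + b₂
  occ-x≡ = trans (cong₂ _+_ (occ-x-xy a (suc k)) (trans (occ-++ x (xy b₁ (suc s₁′)) _) (cong₂ _+_ (occ-x-xy b₁ _) (occ-x-xy b₂ _))))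
                 (sym (+-assoc a b₁ b₂))
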